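{- Let $N=(P,T,F)$ be a safe and sound WF-net and $G=\{T_1,\dots,T_n\}$ such that $(N,G)$ is a partial order pattern. For each $k\in\{1,\dots,n\}$ let $N_k=\mathrm{poproject}(N,T_k)$. Then each $N_k$ is a safe and sound WF-net.
   Context: A Petri net is a triple $N=(P,T,F)$ with finite disjoint sets $P$ (places) and $T$ (transitions) and flow relation $F\subseteq(P\times T)\cup(T\times P)$; each transition has a label in $\mathcal{A}\cup\{\tau\}$ ($\tau$ the silent label). For a node $x$, ${}^\bullet x=\{y\mid (y,x)\in F\}$ and $x^\bullet=\{y\mid (x,y)\in F\}$. A marking is a multiset of places; $t$ is enabled if every place of ${}^\bullet t$ holds a token, and firing it removes one token from each place of ${}^\bullet t$ and adds one to each place of $t^\bullet$. $N$ is a WF-net if there are places $i_N$, $o_N$ with $\{p\mid {}^\bullet p=\emptyset\}=\{i_N\}$, $\{p\mid p^\bullet=\emptyset\}=\{o_N\}$, and every node lies on a directed path from $i_N$ to $o_N$. A WF-net is safe if no marking reachable from $[i_N]$ has a place with more than one token; it is sound if (i) every transition is enabled in some marking reachable from $[i_N]$, (ii) from every marking reachable from $[i_N]$ the marking $[o_N]$ is reachable, and (iii) $[o_N]$ is the only reachable marking with a token in $o_N$. Notation: for $T'\subseteq T$, $P|_{T'}=\{p\in P\mid({}^\bullet p\cup p^\bullet)\cap T'\ne\emptyset\}$; for $P'\subseteq P$, $F|_{P',T'}=F\cap((P'\times T')\cup(T'\times P'))$; $p\approx_{T'}p'$ iff ${}^\bullet p\cap T'={}^\bullet p'\cap T'$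 and $p^\bullet\cap T'=p'^\bullet\cap T'$; $\mathrm{Pre}(T')=\{p\in P\mid T'\cap p^\bullet\ne\emptyset\wedge(p=i_N\vee (T\setminus T')\cap{}^\bullet p\ne\emptyset)\}$; $\mathrm{Post}(T')=\{p\in P\mid T'\cap{}^\bullet p\ne\emptyset\wedge(p=o_N\vee(T\setminus T')\cap p^\bullet\ne\emptyset)\}$. For a partition $G=\{T_1,\dots,T_n\}$, $\mathit{order}(N,G)=\{(i,j)\mid\mathrm{Post}(T_i)\cap\mathrm{Pre}(T_j)\ne\emptyset\}$; $R^+$ is the transitive closure; $G_t$ is the part containing $t$. Transition reachability: $t\rightsquigarrow t'$ iff there are $n\ge1$, places $p_1,\dots,p_n$ and transitions $t_1=t,\dots,t_{n+1}=t'$ with $(t_k,p_k),(p_k,t_{k+1})\in F$ for all $k$. Partial order pattern: for a safe and sound WF-net $N$ and a partition $G=\{T_1,\dots,T_n\}$ of $T$ with $n\ge2$, $(N,G)$ is a partial order pattern iff (1) for every $p\in P$ and all $t,t'\in\{u\in T\mid\exists t_1,t_2\in p^\bullet: t_1\rightsquigarrow u\wedge t_2\not\rightsquigarrow u\}$, $G_t=G_{t'}$; (2) $\mathit{order}(N,G)^+$ is a strict partial order (irreflexive and transitive); (3) for all $k$ and $p,p'\in\mathrm{Pre}(T_k)$, $p\approx_{T_k}p'$; (4) for all $k$ and $p,p'\in\mathrm{Post}(T_k)$, $p\approx_{T_k}p'$. Partial order projection: for $T'\in G$, let $p_s,p_e\notin P$ be fresh places and $N'=(P',T',F')$ with $P'=(P|_{T'}\setminus(\mathrm{Pre}(T')\cup\mathrm{Post}(T')))\cup\{p_s,p_e\}$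 and $F'=F|_{P',T'}\cup\{(p_s,t)\mid t\in T',(p,t)\in F,p\in\mathrm{Pre}(T')\}\cup\{(t,p_s)\mid t\in T',(t,p)\in F,p\in\mathrm{Pre}(T')\}\cup\{(p_e,t)\mid t\in T',(p,t)\in F,p\in\mathrm{Post}(T')\}\cup\{(t,p_e)\mid t\in T',(t,p)\in F,p\in\mathrm{Post}(T')\}$. Then $\mathrm{poproject}(N,T')$ is obtained from $N'$ by normalization: if ${}^\bullet p_s\ne\emptyset$ in $N'$, add a fresh place $p_s'$ and a fresh $\tau$-labelled transition $t_s$ with arcs $(p_s',t_s),(t_s,p_s)$; if $p_e^\bullet\ne\emptyset$ in $N'$, add a fresh $\tau$-labelled transition $t_e$ and fresh place $p_e'$ with arcs $(p_e,t_e),(t_e,p_e')$. -}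

module Defs where

open import Data.Bool using (Bool; true; false; T; _∧_; _∨_; not; if_then_else_)
open import Data.Bool.Properties using (T-irrelevant)
open import Data.Nat using (ℕ; _≤_; _∸_; _+_)
open import Data.Fin using (Fin) renaming (_≟_ to _≟F_)
open import Data.List using (allFin)
open import Data.Bool.ListAction using (any)
open import Data.Maybe using (Maybe; just; nothing)
open import Data.Product using (Σ; ∃; ∃-syntax; _×_; _,_)
open import Data.Sum using (_⊎_; inj₁; inj₂)
open import Data.Empty using (⊥)
open import Data.Unit using (tt)
open import Relation.Nullary using (¬_; yes; no)
open import Relation.Nullary.Decidable using (⌊_⌋)
open import Relation.Binary.Definitions using (DecidableEquality)
open import Relation.Binary.Structures using (IsStrictPartialOrder)
open import Relation.Binary.PropositionalEquality using (_≡_; refl; cong)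
open import Relation.Binary.Construct.Closure.ReflexiveTransitive using (Star)
open import Relation.Binary.Construct.Closure.Transitive using (TransClosure)

-- Flow relation F is given by two Boolean predicates:
--   inArc p t = true  iff (p , t) ∈ F
--   outArc t p = true iff (t , p) ∈ F
-- Labels: nothing = τ (silent), just a = a ∈ 𝒜.

record Net (A : Set) : Set₁ where
  field
    Place  : Set
    Trans  : Set
    _≟P_   : DecidableEquality Place
    inArc  : Place → Trans → Bool
    outArc : Trans → Place → Bool
    label  : Trans → Maybe A
    iN     : Place
    oN     : Place

record FinNet (A : Set) (m k : ℕ) : Set where
  field
    inArc  : Fin m → Fin k → Bool
    outArc : Fin k → Fin m → Bool
    label  : Fin k → Maybe A
    iN     : Fin m
    oN     : Fin m

toNet : ∀ {A m k} → FinNet A m k → Net A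
toNet {A} {m} {k} N = record
  { Place = Fin m ; Trans = Fin k ; _≟P_ = _≟F_
  ; inArc = FinNet.inArc N ; outArc = FinNet.outArc N ; label = FinNet.label N
  ; iN = FinNet.iN N ; oN = FinNet.oN N }

module _ {A : Set} (N : Net A) where
  open Net N

  data Node : Set where
    pl : Place → Node
    tr : Trans → Node

  Edge : Node → Node → Set
  Edge (pl p) (tr t) = T (inArc p t)
  Edge (tr t) (pl p) = T (outArc t p)
  Edge _ _ = ⊥

  NoPre : Place → Set
  NoPre p = ∀ t → outArc t p ≡ false

  NoPost : Place → Set
  NoPost p = ∀ t → inArc p t ≡ false

  record IsWF : Set where
    field
      source-only-i : ∀ p → NoPre p → p ≡ iN
      i-source      : NoPre iN
      sink-only-o   : ∀ p → NoPost p → p ≡ oN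
      o-sink        : NoPost oN
      on-path       : ∀ x → Star Edge (pl iN) x × Star Edge x (pl oN)

  Marking : Set
  Marking = Place → ℕ

  ⟦_⟧ : Place → Marking
  ⟦ q ⟧ p = if ⌊ p ≟P q ⌋ then 1 else 0

  _≐_ : Marking → Marking → Set
  M ≐ M' = ∀ p → M p ≡ M' p

  Enabled : Marking → Trans → Set
  Enabled M t = ∀ p → T (inArc p t) → 1 ≤ M p

  fire : Marking → Trans → Marking
  fire M t p = (M p ∸ (if inArc p t then 1 else 0)) + (if outArc t p then 1 else 0)

  Step : Marking → Marking → Set
  Step M M' = ∃[ t ] (Enabled M t × M' ≐ fire M t)

  Reach : Marking → Marking → Set
  Reach = Star Step

  Safe : Set
  Safe = ∀ M → Reach ⟦ iN ⟧ M → ∀ p → M p ≤ 1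

  record Sound : Set where
    field
      no-dead     : ∀ t → ∃[ M ] (Reach ⟦ iN ⟧ M × Enabled M t)
      option      : ∀ M → Reach ⟦ iN ⟧ M → ∃[ M' ] (Reach M M' × M' ≐ ⟦ oN ⟧)
      proper      : ∀ M → Reach ⟦ iN ⟧ M → 1 ≤ M oN → M ≐ ⟦ oN ⟧

anyFin : ∀ {k} → (Fin k → Bool) → Bool
anyFin {k} f = any f (allFin k)

-- Partitions G = {T_1,…,T_n} are given by  part : Fin k → Fin n ,
-- T_j = { t | part t ≡ j }.

module PO {A : Set} {m k n : ℕ} (N : FinNet A m k) (part : Fin k → Fin n) where
  open FinNet N

  inBlock : Fin n → Fin k → Bool
  inBlock j t = ⌊ part t ≟F j ⌋

  touches : Fin n → Fin m → Bool
  touches j p = anyFin (λ t → inBlock j t ∧ (outArc t p ∨ inArc p t))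

  isPre : Fin n → Fin m → Bool
  isPre j p = anyFin (λ t → inBlock j t ∧ inArc p t)
            ∧ (⌊ p ≟F iN ⌋ ∨ anyFin (λ t → not (inBlock j t) ∧ outArc t p))

  isPost : Fin n → Fin m → Bool
  isPost j p = anyFin (λ t → inBlock j t ∧ outArc t p)
             ∧ (⌊ p ≟F oN ⌋ ∨ anyFin (λ t → not (inBlock j t) ∧ inArc p t))

  Equiv : Fin n → Fin m → Fin m → Set
  Equiv j p p' = ∀ t → T (inBlock j t) →
    (outArc t p ≡ outArc t p') × (inArc p t ≡ inArc p' t)

  Order : Fin n → Fin n → Set
  Order a b = ∃[ p ] T (isPost a p ∧ isPre b p)

  TT : Fin k → Fin k → Set
  TT t t' = ∃[ p ] (T (outArc t p) × T (inArc p t'))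

  _⇝_ : Fin k → Fin k → Set
  _⇝_ = TransClosure TT

  Split : Fin m → Fin k → Set
  Split p u = ∃[ t₁ ] ∃[ t₂ ] (T (inArc p t₁) × T (inArc p t₂) × t₁ ⇝ u × ¬ (t₂ ⇝ u))

  record IsPOPattern : Set where
    field
      two-blocks    : 2 ≤ n
      blocks-nonempty : ∀ j → ∃[ t ] part t ≡ j
      cond1 : ∀ p t t' → Split p t → Split p t' → part t ≡ part t'
      cond2 : IsStrictPartialOrder _≡_ (TransClosure Order)
      cond3 : ∀ j p p' → T (isPre j p) → T (isPre j p') → Equiv j p p'
      cond4 : ∀ j p p' → T (isPost j p) → T (isPost j p') → Equiv j p p'

module Projection {A : Set} {m k n : ℕ} (N : FinNet A m k)
                  (part : Fin k → Fin n) (j : Fin n) where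
  open FinNet N
  open PO N part

  keep : Fin m → Bool
  keep p = touches j p ∧ not (isPre j p) ∧ not (isPost j p)

  toS fromS toE fromE : Fin k → Bool
  toS   t = anyFin (λ p → isPre j p ∧ outArc t p)
  fromS t = anyFin (λ p → isPre j p ∧ inArc p t)
  toE   t = anyFin (λ p → isPost j p ∧ outArc t p)
  fromE t = anyFin (λ p → isPost j p ∧ inArc p t)

  needS needE : Bool
  needS = anyFin (λ t → inBlock j t ∧ toS t)
  needE = anyFin (λ t → inBlock j t ∧ fromE t)

  data PPlace : Set where
    inner : (p : Fin m) → T (keep p) → PPlace
    ps    : PPlace
    pe    : PPlace
    ps'   : T needS → PPlace
    pe'   : T needE → PPlace

  data PTrans : Set where
    orig : (t : Fin k) → part t ≡ j → PTrans
    ts   : T needS → PTrans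
    te   : T needE → PTrans

  _≟PP_ : DecidableEquality PPlace
  inner p x ≟PP inner q y with p ≟F q
  ... | yes refl = yes (cong (inner p) (T-irrelevant x y))
  ... | no ne = no λ { refl → ne refl }
  inner _ _ ≟PP ps = no λ ()
  inner _ _ ≟PP pe = no λ ()
  inner _ _ ≟PP ps' _ = no λ ()
  inner _ _ ≟PP pe' _ = no λ ()
  ps ≟PP inner _ _ = no λ ()
  ps ≟PP ps = yes refl
  ps ≟PP pe = no λ ()
  ps ≟PP ps' _ = no λ ()
  ps ≟PP pe' _ = no λ ()
  pe ≟PP inner _ _ = no λ ()
  pe ≟PP ps = no λ ()
  pe ≟PP pe = yes refl
  pe ≟PP ps' _ = no λ ()
  pe ≟PP pe' _ = no λ ()
  ps' _ ≟PP inner _ _ = no λ ()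
  ps' _ ≟PP ps = no λ ()
  ps' _ ≟PP pe = no λ ()
  ps' x ≟PP ps' y = yes (cong ps' (T-irrelevant x y))
  ps' _ ≟PP pe' _ = no λ ()
  pe' _ ≟PP inner _ _ = no λ ()
  pe' _ ≟PP ps = no λ ()
  pe' _ ≟PP pe = no λ ()
  pe' _ ≟PP ps' _ = no λ ()
  pe' x ≟PP pe' y = yes (cong pe' (T-irrelevant x y))

  pIn : PPlace → PTrans → Bool
  pIn (inner p _) (orig t _) = inArc p t
  pIn ps          (orig t _) = fromS t
  pIn pe          (orig t _) = fromE t
  pIn (ps' _)     (ts _)     = true
  pIn pe          (te _)     = true
  pIn _           _          = false

  pOut : PTrans → PPlace → Bool
  pOut (orig t _) (inner p _) = outArc t p
  pOut (orig t _) ps          = toS t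
  pOut (orig t _) pe          = toE t
  pOut (ts _)     ps          = true
  pOut (te _)     (pe' _)     = true
  pOut _          _           = false

  pLabel : PTrans → Maybe A
  pLabel (orig t _) = label t
  pLabel (ts _)     = nothing
  pLabel (te _)     = nothing

  -- input place after normalization: p_s' if added, otherwise p_s
  source : (b : Bool) → (T b → PPlace) → PPlace → PPlace
  source true  f _ = f tt
  source false _ d = d

  net : Net A
  net = record
    { Place = PPlace ; Trans = PTrans ; _≟P_ = _≟PP_
    ; inArc = pIn ; outArc = pOut ; label = pLabel
    ; iN = source needS ps' ps
    ; oN = source needE pe' pe }

poproject : ∀ {A m k n} → FinNet A m k → (Fin k → Fin n) → Fin n → Net A
poproject N part j = Projection.net N part j

SafeSoundWF : ∀ {A} → Net A → Set
SafeSoundWF N = IsWF N × Safe N × Sound N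

module Submission where

-- Conditions (3) and (4) make all places of Pre(T_j), resp. Post(T_j), interchangeable
-- for T_j, so p_s (together with p_s') carries exactly the tokens of every Pre place and p_e
-- (with p_e') at most those of every Post place; this simulation of N_j by N transfers safety.
-- Conversely, after the first T_j-firing from a marking whose T_j-internal places are empty, N_j
-- can follow every run of N. This needs two facts about such runs of N: no transition puts a token
-- back on a Pre place (one that depends on T_j would close a cycle in order(N,G), condition (2);
-- an independent one can be replayed before T_j started, where it overflows the Pre place), and
-- once every Post place is marked no token is left inside T_j (each further T_j-firing would
-- either overflow a Post place or strand a token that only T_j can remove, so [o_N] would be
-- unreachable). Soundness of N then yields option to complete, proper completion and liveness of
-- N_j. The workflow structure of N_j is obtained by mapping paths of N.

open import Defs
open import Data.Bool using (Bool; true; false; T; _∧_; _∨_; not; if_then_else_)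
open import Data.Bool.Properties using (T?; T-∧; T-∨; T-≡; T-not-≡; T-irrelevant)
open import Data.Empty using (⊥; ⊥-elim)
open import Data.Fin using (Fin) renaming (_≟_ to _≟F_)
open import Data.Fin.Properties using (any?)
open import Data.List using (allFin)
open import Data.List.Membership.Propositional using (lose)
open import Data.List.Membership.Propositional.Properties using (∈-allFin)
open import Data.List.Relation.Unary.Any using (satisfied)
open import Data.List.Relation.Unary.Any.Properties using (any⁺; any⁻)
open import Data.Nat using (ℕ; zero; suc; _≤_; _∸_; _+_; z≤n; s≤s; s≤s⁻¹; _≟_)
open import Data.Nat.Properties
  using (≤-refl; ≤-trans; ≤-reflexive; ≤-antisym; <⇒≱; ≮⇒≥; n≤1+n; n≤0⇒n≡0; n≢0⇒n>0; m<n⇒n≢0; m≤m+n; m≤n+m;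
         suc-injective; +-assoc; +-comm; +-identityʳ; +-∸-comm; m+n≡0⇒m≡0; m+n≡0⇒n≡0; +-monoˡ-≤; ∸-monoˡ-≤)
open import Data.Product using (∃-syntax; _×_; _,_; proj₁; proj₂)
open import Data.Sum using (_⊎_; inj₁; inj₂)
open import Data.Unit using (tt)
open import Function.Bundles using (Equivalence)
open import Relation.Binary.Construct.Closure.ReflexiveTransitive using (Star; ε; _◅_; _◅◅_)
open import Relation.Binary.Construct.Closure.Transitive using (TransClosure; [_]; _∷_; _++_; _∷ʳ_)
open import Relation.Binary.PropositionalEquality
  using (_≡_; _≢_; refl; sym; trans; cong; cong₂; subst; ≢-sym; module ≡-Reasoning)
open import Relation.Binary.Structures using (IsStrictPartialOrder)
open import Relation.Nullary using (¬_; yes; no; _×-dec_)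
open import Relation.Nullary.Decidable using (⌊_⌋; toWitness; fromWitness; fromWitnessFalse)

open Equivalence using (to; from)

¬T⇒≡false : ∀ {b} → ¬ T b → b ≡ false
¬T⇒≡false {false} _ = refl
¬T⇒≡false {true} ¬b = ⊥-elim (¬b _)

anyFin⁺ : ∀ {k} (f : Fin k → Bool) x → T (f x) → T (anyFin f)
anyFin⁺ f x fx = any⁺ f (lose (∈-allFin x) fx)

anyFin⁻ : ∀ {k} (f : Fin k → Bool) → T (anyFin f) → ∃[ x ] T (f x)
anyFin⁻ {k} f h = satisfied (any⁻ f (allFin k) h)

anyFin-∧⁻ : ∀ {k} (f g : Fin k → Bool) → T (anyFin (λ x → f x ∧ g x)) → ∃[ x ] T (f x) × T (g x)
anyFin-∧⁻ f g h with anyFin⁻ _ h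
... | x , fx∧gx = x , to (T-∧ {f x}) fx∧gx

Star-last : ∀ {I : Set} {R : I → I → Set} {x y} → Star R x y → x ≡ y ⊎ ∃[ z ] R z y
Star-last ε = inj₁ refl
Star-last (r ◅ rs) with Star-last rs
... | inj₁ refl = inj₂ (_ , r)
... | inj₂ last = inj₂ last

[m∸o+p]+n≡[m+n∸o]+p : ∀ m n p o → o ≤ m → (m ∸ o + p) + n ≡ (m + n ∸ o) + p
[m∸o+p]+n≡[m+n∸o]+p m n p o o≤m = begin
  (m ∸ o + p) + n   ≡⟨ +-assoc (m ∸ o) p n ⟩
  m ∸ o + (p + n)   ≡⟨ cong (m ∸ o +_) (+-comm p n) ⟩
  m ∸ o + (n + p)   ≡⟨ sym (+-assoc (m ∸ o) n p) ⟩
  (m ∸ o + n) + p   ≡⟨ cong (_+ p) (sym (+-∸-comm n o≤m)) ⟩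
  (m + n ∸ o) + p   ∎
  where open ≡-Reasoning

m+n≡1⇒n≡0 : ∀ {m n} → 1 ≤ m → m + n ≡ 1 → n ≡ 0
m+n≡1⇒n≡0 {suc m} _ m+n≡1 = m+n≡0⇒n≡0 m (suc-injective m+n≡1)

[m+1]+[n∸1+0]≡m+n : ∀ m n → 1 ≤ n → (m + 1) + (n ∸ 1 + 0) ≡ m + n
[m+1]+[n∸1+0]≡m+n m (suc n) _ = trans (cong ((m + 1) +_) (+-identityʳ n)) (+-assoc m 1 n)

arc-weight-≤ : ∀ {b a} → (T b → 1 ≤ a) → (if b then 1 else 0) ≤ a
arc-weight-≤ {false} _ = z≤n
arc-weight-≤ {true} marked = marked _

module NetProperties {A : Set} (N : Net A) where
  open Net N

  ⟦⟧-self : ∀ q → ⟦_⟧ N q q ≡ 1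
  ⟦⟧-self q with q ≟P q
  ... | yes _ = refl
  ... | no q≢q = ⊥-elim (q≢q refl)

  ⟦⟧-other : ∀ {p q} → p ≢ q → ⟦_⟧ N q p ≡ 0
  ⟦⟧-other {p} {q} p≢q with p ≟P q
  ... | yes p≡q = ⊥-elim (p≢q p≡q)
  ... | no _ = refl

  ≐-⟦⟧ : ∀ {M} q → M q ≡ 1 → (∀ p → p ≢ q → M p ≡ 0) → _≐_ N M (⟦_⟧ N q)
  ≐-⟦⟧ q Mq≡1 M≡0 p with p ≟P q
  ... | yes refl = Mq≡1
  ... | no p≢q = M≡0 p p≢q

  fire-≤ : ∀ M {t p} → outArc t p ≡ false → fire N M t p ≤ M p
  fire-≤ M {t} {p} out≡false rewrite out≡false with inArc p t
  ... | false = ≤-reflexive (+-identityʳ (M p))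
  ... | true with M p
  ...   | zero  = z≤n
  ...   | suc a = ≤-trans (≤-reflexive (+-identityʳ a)) (n≤1+n a)

  fire-keeps-empty : ∀ M {t p} → M p ≡ 0 → outArc t p ≡ false → fire N M t p ≡ 0
  fire-keeps-empty M {t} {p} empty unproduced =
    n≤0⇒n≡0 (≤-trans (fire-≤ M unproduced) (≤-reflexive empty))

  fire-≥ : ∀ M {t p} → inArc p t ≡ false → M p ≤ fire N M t p
  fire-≥ M {t} {p} in≡false rewrite in≡false = m≤m+n (M p) _

  fire-marks : ∀ M {t p} → T (outArc t p) → 1 ≤ fire N M t p
  fire-marks M {t} {p} out with outArc t p
  ... | true = m≤n+m 1 _

  fire-idle : ∀ M {t p} → inArc p t ≡ false → outArc t p ≡ false → fire N M t p ≡ M p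
  fire-idle M {t} {p} in≡false out≡false rewrite in≡false | out≡false = +-identityʳ (M p)

  fire-adds : ∀ M {t p} → inArc p t ≡ false → outArc t p ≡ true → fire N M t p ≡ suc (M p)
  fire-adds M {t} {p} in≡false out≡true rewrite in≡false | out≡true = +-comm (M p) 1

  fire-empties : ∀ M {t p} → inArc p t ≡ true → outArc t p ≡ false → M p ≤ 1 → fire N M t p ≡ 0
  fire-empties M {t} {p} in≡true out≡false Mp≤1 rewrite in≡true | out≡false with M p
  ... | zero = refl
  ... | suc zero = refl
  ... | suc (suc _) with Mp≤1
  ...   | s≤s ()

  fire-cong : ∀ M M' {t p} → M p ≡ M' p → fire N M t p ≡ fire N M' t p
  fire-cong M M' {t} {p} e = cong (λ a → (a ∸ (if inArc p t then 1 else 0)) + (if outArc t p then 1 else 0)) e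

  fire-mono : ∀ M M' t p → M p ≤ M' p → fire N M t p ≤ fire N M' t p
  fire-mono M M' t p M≤M' =
    +-monoˡ-≤ (if outArc t p then 1 else 0) (∸-monoˡ-≤ (if inArc p t then 1 else 0) M≤M')

  step-fire : ∀ {M t} → Enabled N M t → Step N M (fire N M t)
  step-fire en = _ , en , λ _ → refl

  safe-≡1 : Safe N → ∀ {M} → Reach N (⟦_⟧ N iN) M → ∀ {p} → 1 ≤ M p → M p ≡ 1
  safe-≡1 safe r {p} 1≤Mp = ≤-antisym (safe _ r p) 1≤Mp

  safe-no-overflow : Safe N → ∀ {M t p} → Reach N (⟦_⟧ N iN) M → Enabled N M t → 1 ≤ M p →
                     inArc p t ≡ false → ¬ T (outArc t p)
  safe-no-overflow safe {M} {t} {p} r en marked unconsumed produces =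
    <⇒≱ (s≤s marked) (≤-trans (≤-reflexive (sym (fire-adds M unconsumed (to T-≡ produces))))
                              (safe _ (r ◅◅ step-fire en ◅ ε) p))

  first-production : ∀ {M M' p} → M p ≡ 0 → Reach N M M' → 1 ≤ M' p →
                     ∃[ M″ ] Reach N M M″ × ∃[ t ] Enabled N M″ t × T (outArc t p)
  first-production empty ε marked = ⊥-elim (m<n⇒n≢0 marked empty)
  first-production {M} {p = p} empty ((t , en , fired) ◅ run) marked with T? (outArc t p)
  ... | yes produces = M , ε , t , en , produces
  ... | no unproduced with first-production (trans (fired p) (fire-keeps-empty M empty (¬T⇒≡false unproduced))) run marked
  ...   | M″ , run′ , rest = M″ , (t , en , fired) ◅ run′ , rest

  module _ (wf : IsWF N) where
    open IsWF wf

    ∃-producer : ∀ {p} → p ≢ iN → ∃[ t ] T (outArc t p)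
    ∃-producer {p} p≢i with Star-last (proj₁ (on-path (pl p)))
    ... | inj₁ refl = ⊥-elim (p≢i refl)
    ... | inj₂ (tr t , e) = t , e

    ∃-consumer : ∀ {p} → p ≢ oN → ∃[ t ] T (inArc p t)
    ∃-consumer {p} p≢o with proj₂ (on-path (pl p))
    ... | ε = ⊥-elim (p≢o refl)
    ... | _◅_ {j = tr t} e _ = t , e

    ∃-input : ∀ t → ∃[ p ] T (inArc p t)
    ∃-input t with Star-last (proj₁ (on-path (tr t)))
    ... | inj₂ (pl p , e) = p , e

    ∃-output : ∀ t → ∃[ p ] T (outArc t p)
    ∃-output t with proj₂ (on-path (tr t))
    ... | _◅_ {j = pl p} e _ = p , e

    Reach-preserves-marked : ∀ {M M'} → Reach N M M' → ∃[ p ] 1 ≤ M p → ∃[ p ] 1 ≤ M' p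
    Reach-preserves-marked ε marked = marked
    Reach-preserves-marked {M} ((t , en , fired) ◅ run) _ with ∃-output t
    ... | p , produces = Reach-preserves-marked run (p , ≤-trans (fire-marks M produces) (≤-reflexive (sym (fired p))))

    consumed⇒≢oN : ∀ {p t} → T (inArc p t) → p ≢ oN
    consumed⇒≢oN {t = t} e refl with inArc oN t | o-sink t
    ... | false | _ = e

    produced⇒≢iN : ∀ {p t} → T (outArc t p) → p ≢ iN
    produced⇒≢iN {t = t} e refl with outArc t iN | i-source t
    ... | false | _ = e


module BlockOrder {A : Set} {m k n : ℕ} (N : FinNet A m k) (part : Fin k → Fin n) where
  open FinNet N
  open PO N part

  FedFromOutside DrainedToOutside : Fin n → Fin m → Set
  FedFromOutside b p = p ≡ iN ⊎ ∃[ u ] part u ≢ b × T (outArc u p)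
  DrainedToOutside b p = p ≡ oN ⊎ ∃[ u ] part u ≢ b × T (inArc p u)

  isPre-intro : ∀ {b t p} → part t ≡ b → T (inArc p t) → FedFromOutside b p → T (isPre b p)
  isPre-intro {b} {t} {p} t∈b consumes fed = from T-∧ (consumed , from T-∨ (fed′ fed))
    where
    consumed : T (anyFin (λ u → inBlock b u ∧ inArc p u))
    consumed = anyFin⁺ _ t (from T-∧ (fromWitness t∈b , consumes))
    fed′ : FedFromOutside b p → T ⌊ p ≟F iN ⌋ ⊎ T (anyFin (λ u → not (inBlock b u) ∧ outArc u p))
    fed′ (inj₁ p≡i) = inj₁ (fromWitness p≡i)
    fed′ (inj₂ (u , u∉b , produces)) = inj₂ (anyFin⁺ _ u (from T-∧ (fromWitnessFalse u∉b , produces)))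

  isPost-intro : ∀ {b t p} → part t ≡ b → T (outArc t p) → DrainedToOutside b p → T (isPost b p)
  isPost-intro {b} {t} {p} t∈b produces drained = from T-∧ (produced , from T-∨ (drained′ drained))
    where
    produced : T (anyFin (λ u → inBlock b u ∧ outArc u p))
    produced = anyFin⁺ _ t (from T-∧ (fromWitness t∈b , produces))
    drained′ : DrainedToOutside b p → T ⌊ p ≟F oN ⌋ ⊎ T (anyFin (λ u → not (inBlock b u) ∧ inArc p u))
    drained′ (inj₁ p≡o) = inj₁ (fromWitness p≡o)
    drained′ (inj₂ (u , u∉b , consumes)) = inj₂ (anyFin⁺ _ u (from T-∧ (fromWitnessFalse u∉b , consumes)))

  arc-order : ∀ {t t'} → part t ≢ part t' → TT t t' → Order (part t) (part t')
  arc-order {t} {t'} t≢t' (p , produces , consumes) =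
    p , from (T-∧ {isPost (part t) p})
             ( isPost-intro refl produces (inj₂ (t' , ≢-sym t≢t' , consumes))
             , isPre-intro refl consumes (inj₂ (t , t≢t' , produces)))

  ⇝-order : ∀ {t t'} → t ⇝ t' → part t ≡ part t' ⊎ TransClosure Order (part t) (part t')
  ⇝-order {t} {t'} [ arc ] with part t ≟F part t'
  ... | yes same = inj₁ same
  ... | no t≢t' = inj₂ [ arc-order t≢t' arc ]
  ⇝-order {t' = t'} (arc ∷ path) with ⇝-order [ arc ] | ⇝-order path
  ... | inj₁ same | inj₁ same′ = inj₁ (trans same same′)
  ... | inj₁ same | inj₂ rest = inj₂ (subst (λ b → TransClosure Order b (part t')) (sym same) rest)
  ... | inj₂ first | inj₁ same = inj₂ (subst (TransClosure Order _) same first)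
  ... | inj₂ first | inj₂ rest = inj₂ (first ++ rest)

anyFin-∧-≡ : ∀ {k} (P g : Fin k → Bool) → (∀ x y → T (P x) → T (P y) → g x ≡ g y) →
             ∀ {x} → T (P x) → anyFin (λ y → P y ∧ g y) ≡ g x
anyFin-∧-≡ P g const {x} Px with g x in gx
... | true = to T-≡ (anyFin⁺ _ x (from T-∧ (Px , from T-≡ gx)))
... | false with anyFin (λ y → P y ∧ g y) in any≡
...   | false = refl
...   | true with anyFin-∧⁻ P g (from T-≡ any≡)
...     | y , Py , gy = ⊥-elim (subst T (trans (const y x Py Px) gx) gy)

module Block {A : Set} {m k n : ℕ} (N : FinNet A m k) (part : Fin k → Fin n)
             (wf : IsWF (toNet N)) (po : PO.IsPOPattern N part) (j : Fin n) where
  open FinNet N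
  open PO N part
  open PO.IsPOPattern po
  open Projection N part j using (keep; toS; fromS; toE; fromE; needS; needE)
  open BlockOrder N part
  open NetProperties (toNet N)
  private module SPO = IsStrictPartialOrder cond2

  InBlock : Fin k → Set
  InBlock t = part t ≡ j

  Pre Post Inner : Fin m → Set
  Pre p = T (isPre j p)
  Post p = T (isPost j p)
  Inner p = T (keep p)

  BlockProduced BlockConsumed : Fin m → Set
  BlockProduced q = q ≢ iN × (∀ t → T (outArc t q) → InBlock t)
  BlockConsumed q = q ≢ oN × (∀ t → T (inArc q t) → InBlock t)

  in-block⁺ : ∀ (arc : Fin k → Bool) {t} → InBlock t → T (arc t) → T (anyFin (λ u → inBlock j u ∧ arc u))
  in-block⁺ arc {t} t∈J a = anyFin⁺ _ t (from T-∧ (fromWitness t∈J , a))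

  in-block⁻ : ∀ (arc : Fin k → Bool) → T (anyFin (λ u → inBlock j u ∧ arc u)) → ∃[ t ] InBlock t × T (arc t)
  in-block⁻ arc h with anyFin⁻ _ h
  ... | t , t∈J∧a with to (T-∧ {inBlock j t}) t∈J∧a
  ...   | t∈J , a = t , toWitness t∈J , a

  Pre∩Post : ∀ {p} → Pre p → ¬ Post p
  Pre∩Post {p} pre post = SPO.irrefl refl [ p , from (T-∧ {isPost j p}) (post , pre) ]

  Pre⇒consumer : ∀ {p} → Pre p → ∃[ t ] InBlock t × T (inArc p t)
  Pre⇒consumer {p} pre = in-block⁻ (inArc p) (proj₁ (to (T-∧ {anyFin (λ u → inBlock j u ∧ inArc p u)}) pre))

  Post⇒producer : ∀ {p} → Post p → ∃[ t ] InBlock t × T (outArc t p)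
  Post⇒producer {p} post = in-block⁻ (λ u → outArc u p) (proj₁ (to (T-∧ {anyFin (λ u → inBlock j u ∧ outArc u p)}) post))

  block-input : ∀ {t q} → InBlock t → T (inArc q t) → Pre q ⊎ BlockProduced q
  block-input {t} {q} t∈J consumes with isPre j q in pre
  ... | true = inj₁ _
  ... | false = inj₂ ((λ q≡i → not-pre (inj₁ q≡i)) , producers)
    where
    not-pre : ¬ FedFromOutside j q
    not-pre fed = subst T pre (isPre-intro t∈J consumes fed)
    producers : ∀ u → T (outArc u q) → InBlock u
    producers u produces with part u ≟F j
    ... | yes u∈J = u∈J
    ... | no u∉J = ⊥-elim (not-pre (inj₂ (u , u∉J , produces)))

  block-output : ∀ {t q} → InBlock t → T (outArc t q) → Post q ⊎ BlockConsumed q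
  block-output {t} {q} t∈J produces with isPost j q in post
  ... | true = inj₁ _
  ... | false = inj₂ ((λ q≡o → not-post (inj₁ q≡o)) , consumers)
    where
    not-post : ¬ DrainedToOutside j q
    not-post drained = subst T post (isPost-intro t∈J produces drained)
    consumers : ∀ u → T (inArc q u) → InBlock u
    consumers u consumes with part u ≟F j
    ... | yes u∈J = u∈J
    ... | no u∉J = ⊥-elim (not-post (inj₂ (u , u∉J , consumes)))

  BlockProduced⇒BlockConsumed : ∀ {q} → ¬ Post q → BlockProduced q → BlockConsumed q
  BlockProduced⇒BlockConsumed ¬post (q≢i , producers) with ∃-producer wf q≢i
  ... | t , produces with block-output (producers t produces) produces
  ...   | inj₁ post = ⊥-elim (¬post post)
  ...   | inj₂ consumed = consumed

  BlockConsumed⇒BlockProduced : ∀ {q} → ¬ Pre q → BlockConsumed q → BlockProduced q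
  BlockConsumed⇒BlockProduced ¬pre (q≢o , consumers) with ∃-consumer wf q≢o
  ... | t , consumes with block-input (consumers t consumes) consumes
  ...   | inj₁ pre = ⊥-elim (¬pre pre)
  ...   | inj₂ produced = produced

  touches⁺-in : ∀ {t q} → InBlock t → T (inArc q t) → T (touches j q)
  touches⁺-in {t} {q} t∈J consumes = in-block⁺ (λ u → outArc u q ∨ inArc q u) t∈J (from (T-∨ {outArc t q}) (inj₂ consumes))

  touches⁺-out : ∀ {t q} → InBlock t → T (outArc t q) → T (touches j q)
  touches⁺-out {t} {q} t∈J produces = in-block⁺ (λ u → outArc u q ∨ inArc q u) t∈J (from (T-∨ {outArc t q}) (inj₁ produces))

  Inner-intro : ∀ {q} → T (touches j q) → ¬ Pre q → ¬ Post q → Inner q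
  Inner-intro touching ¬pre ¬post =
    from T-∧ (touching , from T-∧ (from T-not-≡ (¬T⇒≡false ¬pre) , from T-not-≡ (¬T⇒≡false ¬post)))

  touches⁻ : ∀ {q} → T (touches j q) → ∃[ t ] InBlock t × (T (outArc t q) ⊎ T (inArc q t))
  touches⁻ {q} touching with in-block⁻ (λ u → outArc u q ∨ inArc q u) touching
  ... | t , t∈J , arc = t , t∈J , to (T-∨ {outArc t q}) arc

  touches-cases : ∀ {q} → T (touches j q) → Inner q ⊎ Pre q ⊎ Post q
  touches-cases {q} touching with T? (isPre j q) | T? (isPost j q)
  ... | yes pre | _        = inj₂ (inj₁ pre)
  ... | no _    | yes post = inj₂ (inj₂ post)
  ... | no ¬pre | no ¬post = inj₁ (Inner-intro touching ¬pre ¬post)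

  Inner⇒¬Pre : ∀ {q} → Inner q → ¬ Pre q
  Inner⇒¬Pre {q} inner = subst T (to T-not-≡ (proj₁ (to (T-∧ {not (isPre j q)}) (proj₂ (to (T-∧ {touches j q}) inner)))))

  Inner⇒¬Post : ∀ {q} → Inner q → ¬ Post q
  Inner⇒¬Post {q} inner = subst T (to T-not-≡ (proj₂ (to (T-∧ {not (isPre j q)}) (proj₂ (to (T-∧ {touches j q}) inner)))))

  Inner⇒BlockProduced : ∀ {q} → Inner q → BlockProduced q
  Inner⇒BlockProduced {q} inner with touches⁻ (proj₁ (to (T-∧ {touches j q}) inner))
  ... | t , t∈J , inj₂ consumes with block-input t∈J consumes
  ...   | inj₁ pre = ⊥-elim (Inner⇒¬Pre inner pre)
  ...   | inj₂ produced = produced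
  Inner⇒BlockProduced {q} inner | t , t∈J , inj₁ produces with block-output t∈J produces
  ...   | inj₁ post = ⊥-elim (Inner⇒¬Post inner post)
  ...   | inj₂ consumed = BlockConsumed⇒BlockProduced (Inner⇒¬Pre inner) consumed

  Inner⇒BlockConsumed : ∀ {q} → Inner q → BlockConsumed q
  Inner⇒BlockConsumed inner = BlockProduced⇒BlockConsumed (Inner⇒¬Post inner) (Inner⇒BlockProduced inner)

  Pre-touches : ∀ {q} → Pre q → T (touches j q)
  Pre-touches pre with Pre⇒consumer pre
  ... | t , t∈J , consumes = touches⁺-in t∈J consumes

  BlockProduced-touches : ∀ {q} → BlockProduced q → T (touches j q)
  BlockProduced-touches (q≢i , producers) with ∃-producer wf q≢i
  ... | t , produces = touches⁺-out (producers t produces) produces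

  BlockConsumed-touches : ∀ {q} → BlockConsumed q → T (touches j q)
  BlockConsumed-touches (q≢o , consumers) with ∃-consumer wf q≢o
  ... | t , consumes = touches⁺-in (consumers t consumes) consumes

  Pre-produced⇒BlockConsumed : ∀ {p t} → Pre p → InBlock t → T (outArc t p) → BlockConsumed p
  Pre-produced⇒BlockConsumed pre t∈J produces with block-output t∈J produces
  ... | inj₁ post = ⊥-elim (Pre∩Post pre post)
  ... | inj₂ consumed = consumed

  Pre-inArc-≡ : ∀ {p p' t} → Pre p → Pre p' → InBlock t → inArc p t ≡ inArc p' t
  Pre-inArc-≡ {p} {p'} {t} pre pre' t∈J = proj₂ (cond3 j p p' pre pre' t (fromWitness t∈J))

  Post-outArc-≡ : ∀ {q q' t} → Post q → Post q' → InBlock t → outArc t q ≡ outArc t q'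
  Post-outArc-≡ {q} {q'} {t} post post' t∈J = proj₁ (cond4 j q q' post post' t (fromWitness t∈J))

  fromS≡inArc : ∀ {p t} → Pre p → InBlock t → fromS t ≡ inArc p t
  fromS≡inArc {t = t} pre t∈J =
    anyFin-∧-≡ (isPre j) (λ q → inArc q t) (λ q q' a b → Pre-inArc-≡ a b t∈J) pre

  toS≡outArc : ∀ {p t} → Pre p → InBlock t → toS t ≡ outArc t p
  toS≡outArc {t = t} pre t∈J =
    anyFin-∧-≡ (isPre j) (outArc t) (λ q q' a b → proj₁ (cond3 j q q' a b t (fromWitness t∈J))) pre

  fromE≡inArc : ∀ {q t} → Post q → InBlock t → fromE t ≡ inArc q t
  fromE≡inArc {t = t} post t∈J =
    anyFin-∧-≡ (isPost j) (λ q → inArc q t) (λ q q' a b → proj₂ (cond4 j q q' a b t (fromWitness t∈J))) post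

  toE≡outArc : ∀ {q t} → Post q → InBlock t → toE t ≡ outArc t q
  toE≡outArc {t = t} post t∈J =
    anyFin-∧-≡ (isPost j) (outArc t) (λ q q' a b → Post-outArc-≡ a b t∈J) post

  needE⇒Post-consumed : T needE → ∀ {q} → Post q → ∃[ t ] InBlock t × T (inArc q t)
  needE⇒Post-consumed needed post with in-block⁻ fromE needed
  ... | t , t∈J , fromE-t = t , t∈J , subst T (fromE≡inArc post t∈J) fromE-t

  needE⇒Post-BlockProduced : T needE → ∀ {q} → Post q → BlockProduced q
  needE⇒Post-BlockProduced needed post with needE⇒Post-consumed needed post
  ... | t , t∈J , consumes with block-input t∈J consumes
  ...   | inj₁ pre = ⊥-elim (Pre∩Post pre post)
  ...   | inj₂ produced = produced

  ¬needE⇒Post-unconsumed : ¬ T needE → ∀ {q t} → Post q → InBlock t → ¬ T (inArc q t)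
  ¬needE⇒Post-unconsumed ¬needed post t∈J consumes =
    ¬needed (in-block⁺ fromE t∈J (subst T (sym (fromE≡inArc post t∈J)) consumes))

  -- By condition (2): otherwise (j , j) would be in order(N,G)⁺.
  no-Pre-feedback : ∀ {t u p} → InBlock t → t ⇝ u → ¬ InBlock u → Pre p → ¬ T (outArc u p)
  no-Pre-feedback {t} {u} {p} t∈J path u∉J pre produces with ⇝-order path | Pre⇒consumer pre
  ... | inj₁ same | _ = u∉J (trans (sym same) t∈J)
  ... | inj₂ order | t' , t'∈J , consumes =
    SPO.irrefl refl (subst (λ b → TransClosure Order b j) t∈J (order ++ [ back ]))
    where
    back : Order (part u) j
    back = subst (Order (part u)) t'∈J (arc-order (λ e → u∉J (trans e t'∈J)) (p , produces , consumes))

  walk-to-Pre : ∀ {q t} → FedFromOutside j q → Star (Edge (toNet N)) (pl q) (tr t) → InBlock t → ∃[ p ] Pre p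
  walk-to-Pre fed (_◅_ {j = tr _} consumes ε) t∈J = _ , isPre-intro t∈J consumes fed
  walk-to-Pre fed (_◅_ {j = tr t₁} consumes (_◅_ {j = pl _} produces path)) t∈J with part t₁ ≟F j
  ... | yes t₁∈J = _ , isPre-intro t₁∈J consumes fed
  ... | no t₁∉J = walk-to-Pre (inj₂ (t₁ , t₁∉J , produces)) path t∈J
  walk-to-Pre fed (_◅_ {j = tr _} _ (_◅_ {j = tr _} () _)) t∈J
  walk-to-Pre fed (_◅_ {j = pl _} () _) t∈J

  walk-to-Post : ∀ {t} → InBlock t → Star (Edge (toNet N)) (tr t) (pl oN) → ∃[ q ] Post q
  walk-to-Post t∈J (_◅_ {j = pl _} produces ε) = _ , isPost-intro t∈J produces (inj₁ refl)
  walk-to-Post t∈J (_◅_ {j = pl _} produces (_◅_ {j = tr t'} consumes path)) with part t' ≟F j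
  ... | yes t'∈J = walk-to-Post t'∈J path
  ... | no t'∉J = _ , isPost-intro t∈J produces (inj₂ (t' , t'∉J , consumes))
  walk-to-Post t∈J (_◅_ {j = pl _} _ (_◅_ {j = pl _} () _))
  walk-to-Post t∈J (_◅_ {j = tr _} () _)

  t₀ : Fin k
  t₀ = proj₁ (blocks-nonempty j)

  t₀∈J : InBlock t₀
  t₀∈J = proj₂ (blocks-nonempty j)

  some-Pre : ∃[ p ] Pre p
  some-Pre = walk-to-Pre (inj₁ refl) (proj₁ (IsWF.on-path wf (tr t₀))) t₀∈J

  some-Post : ∃[ q ] Post q
  some-Post = walk-to-Post t₀∈J (proj₂ (IsWF.on-path wf (tr t₀)))

module BlockRuns {A : Set} {m k n : ℕ} (N : FinNet A m k) (part : Fin k → Fin n)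
                (wf : IsWF (toNet N)) (safe : Safe (toNet N)) (sound : Sound (toNet N))
                (po : PO.IsPOPattern N part) (j : Fin n) where
  open FinNet N
  open PO N part
  open Block N part wf po j
  open NetProperties (toNet N)
  open Projection N part j using (needE)

  𝒩 : Net A
  𝒩 = toNet N

  Reachable : Marking 𝒩 → Set
  Reachable = Reach 𝒩 (⟦_⟧ 𝒩 iN)

  BlockIdle : Marking 𝒩 → Set
  BlockIdle M = ∀ q → BlockProduced q → M q ≡ 0

  record Ready (X : Marking 𝒩) : Set where
    field
      reachable : Reachable X
      idle      : BlockIdle X
      first     : Fin k
      first∈J   : InBlock first
      enabled   : Enabled 𝒩 X first

    first-consumes-Pre : ∀ {p} → Pre p → T (inArc p first)
    first-consumes-Pre pre with ∃-input wf first
    ... | q , consumes with block-input first∈J consumes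
    ...   | inj₁ pre′ = subst T (Pre-inArc-≡ pre′ pre first∈J) consumes
    ...   | inj₂ produced = ⊥-elim (m<n⇒n≢0 (enabled q consumes) (idle q produced))

    Pre-full : ∀ {p} → Pre p → X p ≡ 1
    Pre-full pre = safe-≡1 safe reachable (enabled _ (first-consumes-Pre pre))

  record Started (M : Marking 𝒩) : Set where
    field
      {X Y} : Marking 𝒩
      ready : Ready X
      fired : _≐_ 𝒩 Y (fire 𝒩 X (Ready.first ready))
      run   : Reach 𝒩 Y M
    open Ready ready public

    reachable-now : Reachable M
    reachable-now = reachable ◅◅ (first , enabled , fired) ◅ run

  Started-start : ∀ {X} (ready : Ready X) → Started (fire 𝒩 X (Ready.first ready))
  Started-start ready = record { ready = ready ; fired = λ _ → refl ; run = ε }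

  Started-step : ∀ {M M'} → Started M → Step 𝒩 M M' → Started M'
  Started-step st s = record { Started st ; run = Started.run st ◅◅ s ◅ ε }

  FromBlock : Fin m → Set
  FromBlock q = ∃[ t' ] (∃[ t ] InBlock t × (t ≡ t' ⊎ t ⇝ t')) × T (outArc t' q)

  FromBlock-consumer : ∀ {q u} → FromBlock q → T (inArc q u) → ∃[ t ] InBlock t × t ⇝ u
  FromBlock-consumer {q} (_ , (t , t∈J , inj₁ refl) , produces) consumes = t , t∈J , [ q , produces , consumes ]
  FromBlock-consumer {q} (_ , (t , t∈J , inj₂ path) , produces) consumes = t , t∈J , path ∷ʳ (q , produces , consumes)

  -- Ms replays the run to M without the transitions that (transitively) depend on the block;
  -- the tainted places are those the block may have influenced.
  record Shadow (M Ms : Marking 𝒩) (tainted : Fin m → Bool) : Set where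
    field
      reachable         : Reachable M
      shadow-reachable  : Reachable Ms
      untainted-≤       : ∀ q → ¬ T (tainted q) → M q ≤ Ms q
      tainted-FromBlock : ∀ q → T (tainted q) → FromBlock q
      Pre-marked        : ∀ q → Pre q → 1 ≤ Ms q
      marked-tainted    : ∀ q → Pre q ⊎ BlockProduced q → 1 ≤ M q → T (tainted q)

  module Untainted {M Ms tainted} (I : Shadow M Ms tainted) {v} (en : Enabled 𝒩 M v)
                   (clean : ∀ q → T (inArc q v) → ¬ T (tainted q)) where
    open Shadow I

    shadow-enabled : Enabled 𝒩 Ms v
    shadow-enabled q consumes = ≤-trans (en q consumes) (untainted-≤ q (clean q consumes))

    v∉J : ¬ InBlock v
    v∉J v∈J with ∃-input wf v
    ... | q , consumes = clean q consumes (marked-tainted q (block-input v∈J consumes) (en q consumes))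

    Pre-unconsumed : ∀ {p} → Pre p → inArc p v ≡ false
    Pre-unconsumed {p} pre = ¬T⇒≡false λ consumes → clean p consumes (marked-tainted p (inj₁ pre) (en p consumes))

    Pre-unproduced : ∀ {p} → Pre p → ¬ T (outArc v p)
    Pre-unproduced pre = safe-no-overflow safe shadow-reachable shadow-enabled (Pre-marked _ pre) (Pre-unconsumed pre)

  Shadow-taint : ∀ {M M' Ms tainted v q₁} → Shadow M Ms tainted → (en : Enabled 𝒩 M v) → _≐_ 𝒩 M' (fire 𝒩 M v) →
                 T (inArc q₁ v) → T (tainted q₁) → Shadow M' Ms (λ q → tainted q ∨ outArc v q)
  Shadow-taint {M} {M'} {Ms} {tainted} {v} {q₁} I en fired consumes₁ tainted₁ = record
    { reachable = reachable ◅◅ (v , en , fired) ◅ ε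
    ; shadow-reachable = shadow-reachable
    ; untainted-≤ = λ q untainted → ≤-trans (≤-reflexive (fired q))
        (≤-trans (fire-≤ M (¬T⇒≡false λ o → untainted (from (T-∨ {tainted q}) (inj₂ o))))
                 (untainted-≤ q λ t → untainted (from (T-∨ {tainted q}) (inj₁ t))))
    ; tainted-FromBlock = FromBlock′
    ; Pre-marked = Pre-marked
    ; marked-tainted = marked-tainted′
    }
    where
    open Shadow I
    FromBlock′ : ∀ q → T (tainted q ∨ outArc v q) → FromBlock q
    FromBlock′ q t with to (T-∨ {tainted q}) t
    ... | inj₁ t′ = tainted-FromBlock q t′
    ... | inj₂ produces with FromBlock-consumer (tainted-FromBlock q₁ tainted₁) consumes₁
    ...   | t , t∈J , path = v , (t , t∈J , inj₂ path) , produces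
    marked-tainted′ : ∀ q → Pre q ⊎ BlockProduced q → 1 ≤ M' q → T (tainted q ∨ outArc v q)
    marked-tainted′ q c marked with T? (outArc v q)
    ... | yes o = from (T-∨ {tainted q}) (inj₂ o)
    ... | no ¬o = from (T-∨ {tainted q}) (inj₁ (marked-tainted q c
                    (≤-trans marked (≤-trans (≤-reflexive (fired q)) (fire-≤ M (¬T⇒≡false ¬o))))))

  Shadow-replay : ∀ {M M' Ms tainted v} (I : Shadow M Ms tainted) (en : Enabled 𝒩 M v) → _≐_ 𝒩 M' (fire 𝒩 M v) →
                  (clean : ∀ q → T (inArc q v) → ¬ T (tainted q)) →
                  Shadow M' (fire 𝒩 Ms v) (λ q → tainted q ∧ not (outArc v q))
  Shadow-replay {M} {M'} {Ms} {tainted} {v} I en fired clean = record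
    { reachable = reachable ◅◅ (v , en , fired) ◅ ε
    ; shadow-reachable = shadow-reachable ◅◅ step-fire shadow-enabled ◅ ε
    ; untainted-≤ = untainted-≤′
    ; tainted-FromBlock = λ q t → tainted-FromBlock q (proj₁ (to (T-∧ {tainted q}) t))
    ; Pre-marked = λ q pre → ≤-trans (Pre-marked q pre) (fire-≥ Ms (Pre-unconsumed pre))
    ; marked-tainted = marked-tainted′
    }
    where
    open Shadow I
    open Untainted I en clean
    unproduced : ∀ {q} → Pre q ⊎ BlockProduced q → ¬ T (outArc v q)
    unproduced (inj₁ pre) = Pre-unproduced pre
    unproduced (inj₂ (_ , producers)) produces = v∉J (producers v produces)
    untainted-≤′ : ∀ q → ¬ T (tainted q ∧ not (outArc v q)) → M' q ≤ fire 𝒩 Ms v q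
    untainted-≤′ q untainted with T? (tainted q)
    ... | no ¬t = ≤-trans (≤-reflexive (fired q)) (fire-mono M Ms v q (untainted-≤ q ¬t))
    ... | yes t with T? (outArc v q)
    ...   | no ¬o = ⊥-elim (untainted (from T-∧ (t , from T-not-≡ (¬T⇒≡false ¬o))))
    ...   | yes o = ≤-trans (≤-reflexive (trans (fired q) (trans adds (cong suc Mq≡0)))) (fire-marks Ms o)
      where
      unconsumed : inArc q v ≡ false
      unconsumed = ¬T⇒≡false λ consumes → clean q consumes t
      adds : fire 𝒩 M v q ≡ suc (M q)
      adds = fire-adds M unconsumed (to T-≡ o)
      Mq≡0 : M q ≡ 0
      Mq≡0 = n≤0⇒n≡0 (s≤s⁻¹ (≤-trans (≤-reflexive (sym (trans (fired q) adds)))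
                                     (safe _ (reachable ◅◅ (v , en , fired) ◅ ε) q)))
    marked-tainted′ : ∀ q → Pre q ⊎ BlockProduced q → 1 ≤ M' q → T (tainted q ∧ not (outArc v q))
    marked-tainted′ q c marked =
      from T-∧ ( marked-tainted q c (≤-trans marked (≤-trans (≤-reflexive (fired q)) (fire-≤ M (¬T⇒≡false (unproduced c)))))
               , from T-not-≡ (¬T⇒≡false (unproduced c)))

  Shadow⇒no-Pre-production : ∀ {M Ms tainted Mf} → Shadow M Ms tainted → Reach 𝒩 M Mf →
                              ∀ {u p} → ¬ InBlock u → Enabled 𝒩 Mf u → Pre p → ¬ T (outArc u p)
  Shadow⇒no-Pre-production {tainted = tainted} I ε {u} u∉J en pre
    with any? (λ q → T? (inArc q u) ×-dec T? (tainted q))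
  ... | yes (q , consumes , t) with FromBlock-consumer (Shadow.tainted-FromBlock I q t) consumes
  ...   | t , t∈J , path = no-Pre-feedback t∈J path u∉J pre
  Shadow⇒no-Pre-production I ε u∉J en pre | no clean =
    Untainted.Pre-unproduced I en (λ q consumes t → clean (q , consumes , t)) pre
  Shadow⇒no-Pre-production {tainted = tainted} I ((v , en , fired) ◅ run)
    with any? (λ q → T? (inArc q v) ×-dec T? (tainted q))
  ... | yes (q , consumes , t) = Shadow⇒no-Pre-production (Shadow-taint I en fired consumes t) run
  ... | no clean = Shadow⇒no-Pre-production (Shadow-replay I en fired λ q consumes t → clean (q , consumes , t)) run

  Started⇒Shadow : ∀ {M} (st : Started M) → Shadow (Started.Y st) (Started.X st) (outArc (Started.first st))
  Started⇒Shadow st = record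
    { reachable = reachable ◅◅ (first , enabled , fired) ◅ ε
    ; shadow-reachable = reachable
    ; untainted-≤ = λ q unproduced → ≤-trans (≤-reflexive (fired q)) (fire-≤ X (¬T⇒≡false unproduced))
    ; tainted-FromBlock = λ q produces → first , (first , first∈J , inj₁ refl) , produces
    ; Pre-marked = λ q pre → enabled q (first-consumes-Pre pre)
    ; marked-tainted = marked-tainted
    }
    where
    open Started st
    emptied : ∀ q → Pre q ⊎ BlockProduced q → outArc first q ≡ false → Y q ≡ 0
    emptied q (inj₁ pre) unproduced =
      trans (fired q) (fire-empties X (to T-≡ (first-consumes-Pre pre)) unproduced (safe X reachable q))
    emptied q (inj₂ produced) unproduced = trans (fired q) (fire-keeps-empty X (idle q produced) unproduced)
    marked-tainted : ∀ q → Pre q ⊎ BlockProduced q → 1 ≤ Y q → T (outArc first q)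
    marked-tainted q c marked with T? (outArc first q)
    ... | yes produces = produces
    ... | no unproduced = ⊥-elim (m<n⇒n≢0 marked (emptied q c (¬T⇒≡false unproduced)))

  Started⇒no-Pre-production : ∀ {M} → Started M → ∀ {u p} → ¬ InBlock u → Enabled 𝒩 M u → Pre p → ¬ T (outArc u p)
  Started⇒no-Pre-production st = Shadow⇒no-Pre-production (Started⇒Shadow st) (Started.run st)

  Started-Pre-unfed-empty : ∀ {M p} → Started M → Pre p → (∀ t → InBlock t → ¬ T (outArc t p)) → M p ≡ 0
  Started-Pre-unfed-empty {p = p} st pre unfed = go (record { Started st ; run = ε }) Y-empty run
    where
    open Started st
    Y-empty : Y p ≡ 0
    Y-empty = trans (fired p) (fire-empties X (to T-≡ (first-consumes-Pre pre)) (¬T⇒≡false (unfed first first∈J))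
                                             (safe X reachable p))
    go : ∀ {Z Z'} → Started Z → Z p ≡ 0 → Reach 𝒩 Z Z' → Z' p ≡ 0
    go stZ empty ε = empty
    go {Z} stZ empty ((v , en , fired′) ◅ run′) =
      go (Started-step stZ (v , en , fired′)) (trans (fired′ p) (fire-keeps-empty Z empty unproduced)) run′
      where
      unproduced : outArc v p ≡ false
      unproduced with part v ≟F j
      ... | yes v∈J = ¬T⇒≡false (unfed v v∈J)
      ... | no v∉J = ¬T⇒≡false (Started⇒no-Pre-production stZ v∉J en pre)

  Started⇒no-Pre-consumption : ∀ {M} → Started M → ∀ {u p} → ¬ InBlock u → Enabled 𝒩 M u → Pre p → ¬ T (inArc p u)
  Started⇒no-Pre-consumption st {u} {p} u∉J en pre consumes with any? (λ t → part t ≟F j ×-dec T? (outArc t p))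
  ... | yes (t , t∈J , produces) = u∉J (proj₂ (Pre-produced⇒BlockConsumed pre t∈J produces) u consumes)
  ... | no unfed = m<n⇒n≢0 (en p consumes) (Started-Pre-unfed-empty st pre λ t t∈J o → unfed (t , t∈J , o))

  Started⇒outside-unproduced : ∀ {M} → Started M → ∀ {u q} → ¬ InBlock u → Enabled 𝒩 M u →
                               Pre q ⊎ BlockProduced q → outArc u q ≡ false
  Started⇒outside-unproduced st u∉J en (inj₁ pre) = ¬T⇒≡false (Started⇒no-Pre-production st u∉J en pre)
  Started⇒outside-unproduced st {u} u∉J en (inj₂ (_ , producers)) = ¬T⇒≡false λ o → u∉J (producers u o)

  final-unmarked : ∀ {Mf q} → _≐_ 𝒩 Mf (⟦_⟧ 𝒩 oN) → q ≢ oN → ¬ (1 ≤ Mf q)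
  final-unmarked {Mf} {q} final q≢o marked = m<n⇒n≢0 marked (trans (final q) (⟦⟧-other q≢o))

  Unconsumable : Fin m → Marking 𝒩 → Set
  Unconsumable q₀ M = (∀ t → InBlock t → ¬ T (inArc q₀ t)) ⊎ (BlockProduced q₀ × M q₀ ≡ 0)

  Unconsumable⇒unconsumed : ∀ {q₀ M v} → Unconsumable q₀ M → InBlock v → Enabled 𝒩 M v → inArc q₀ v ≡ false
  Unconsumable⇒unconsumed (inj₁ never) v∈J en = ¬T⇒≡false (never _ v∈J)
  Unconsumable⇒unconsumed {q₀} (inj₂ (_ , empty)) v∈J en =
    ¬T⇒≡false λ consumes → m<n⇒n≢0 (en q₀ consumes) empty

  record Leftover (Mσ Mh : Marking 𝒩) (q₀ : Fin m) : Set where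
    field
      started         : Started Mσ
      dominating      : Reachable Mh
      dominated       : ∀ q → Pre q ⊎ BlockProduced q → Mσ q ≤ Mh q
      q₀-Post         : Post q₀
      q₀-marked       : 1 ≤ Mh q₀
      q₀-unconsumable : Unconsumable q₀ Mσ
      leftover        : ∃[ y ] BlockConsumed y × 1 ≤ Mσ y

  Leftover-outside-step : ∀ {Mσ Mσ' Mh q₀ v} → Leftover Mσ Mh q₀ → (en : Enabled 𝒩 Mσ v) →
                          _≐_ 𝒩 Mσ' (fire 𝒩 Mσ v) → ¬ InBlock v → Leftover Mσ' Mh q₀
  Leftover-outside-step {Mσ} {Mσ'} {Mh} {q₀} {v} L en fired v∉J = record
    { started = Started-step started (v , en , fired)
    ; dominating = dominating
    ; dominated = λ q c → ≤-trans (shrinks q c) (dominated q c)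
    ; q₀-Post = q₀-Post
    ; q₀-marked = q₀-marked
    ; q₀-unconsumable = unconsumable′ q₀-unconsumable
    ; leftover = y , y-consumed , ≤-trans y-marked (≤-trans (fire-≥ Mσ y-unconsumed) (≤-reflexive (sym (fired y))))
    }
    where
    open Leftover L
    y = proj₁ leftover
    y-consumed = proj₁ (proj₂ leftover)
    y-marked = proj₂ (proj₂ leftover)
    y-unconsumed : inArc y v ≡ false
    y-unconsumed = ¬T⇒≡false λ consumes → v∉J (proj₂ y-consumed v consumes)
    shrinks : ∀ q → Pre q ⊎ BlockProduced q → Mσ' q ≤ Mσ q
    shrinks q c = ≤-trans (≤-reflexive (fired q)) (fire-≤ Mσ (Started⇒outside-unproduced started v∉J en c))
    unconsumable′ : Unconsumable q₀ Mσ → Unconsumable q₀ Mσ'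
    unconsumable′ (inj₁ never) = inj₁ never
    unconsumable′ (inj₂ (produced , empty)) =
      inj₂ (produced , n≤0⇒n≡0 (≤-trans (shrinks q₀ (inj₂ produced)) (≤-reflexive empty)))

  -- Condition (4) makes every Post output of a block transition an output into q₀, which is
  -- already marked in the safe marking Mh; so each block firing leaves a token in a BlockConsumed place.
  Leftover-block-step : ∀ {Mσ Mσ' Mh q₀ v} → Leftover Mσ Mh q₀ → (en : Enabled 𝒩 Mσ v) →
                        _≐_ 𝒩 Mσ' (fire 𝒩 Mσ v) → InBlock v → Leftover Mσ' (fire 𝒩 Mh v) q₀
  Leftover-block-step {Mσ} {Mσ'} {Mh} {q₀} {v} L en fired v∈J = record
    { started = Started-step started (v , en , fired)
    ; dominating = dominating ◅◅ step-fire dominating-enabled ◅ ε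
    ; dominated = λ q c → ≤-trans (≤-reflexive (fired q)) (fire-mono Mσ Mh v q (dominated q c))
    ; q₀-Post = q₀-Post
    ; q₀-marked = ≤-trans q₀-marked (fire-≥ Mh q₀-unconsumed)
    ; q₀-unconsumable = unconsumable′ q₀-unconsumable
    ; leftover = leftover′
    }
    where
    open Leftover L
    dominating-enabled : Enabled 𝒩 Mh v
    dominating-enabled q consumes = ≤-trans (en q consumes) (dominated q (block-input v∈J consumes))
    q₀-unconsumed : inArc q₀ v ≡ false
    q₀-unconsumed = Unconsumable⇒unconsumed q₀-unconsumable v∈J en
    q₀-unproduced : ¬ T (outArc v q₀)
    q₀-unproduced = safe-no-overflow safe dominating dominating-enabled q₀-marked q₀-unconsumed
    unconsumable′ : Unconsumable q₀ Mσ → Unconsumable q₀ Mσ'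
    unconsumable′ (inj₁ never) = inj₁ never
    unconsumable′ (inj₂ (produced , empty)) =
      inj₂ (produced , trans (fired q₀) (fire-keeps-empty Mσ empty (¬T⇒≡false q₀-unproduced)))
    leftover′ : ∃[ y ] BlockConsumed y × 1 ≤ Mσ' y
    leftover′ with ∃-output wf v
    ... | q , produces with block-output v∈J produces
    ...   | inj₁ post = ⊥-elim (q₀-unproduced (subst T (Post-outArc-≡ post q₀-Post v∈J) produces))
    ...   | inj₂ consumed = q , consumed , ≤-trans (fire-marks Mσ produces) (≤-reflexive (sym (fired q)))

  Leftover⇒¬final : ∀ {Mσ Mh q₀ Mf} → Leftover Mσ Mh q₀ → Reach 𝒩 Mσ Mf → ¬ _≐_ 𝒩 Mf (⟦_⟧ 𝒩 oN)
  Leftover⇒¬final L ε final with Leftover.leftover L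
  ... | y , (y≢o , _) , y-marked = final-unmarked final y≢o y-marked
  Leftover⇒¬final L ((v , en , fired) ◅ run) with part v ≟F j
  ... | yes v∈J = Leftover⇒¬final (Leftover-block-step L en fired v∈J) run
  ... | no v∉J = Leftover⇒¬final (Leftover-outside-step L en fired v∉J) run

  Started⇒outside-touching-input-Post : ∀ {M} → Started M → ∀ {u q} → ¬ InBlock u → Enabled 𝒩 M u →
                                        T (inArc q u) → T (touches j q) → Post q
  Started⇒outside-touching-input-Post st u∉J en consumes touching with touches-cases touching
  ... | inj₁ inner = ⊥-elim (u∉J (proj₂ (Inner⇒BlockConsumed inner) _ consumes))
  ... | inj₂ (inj₁ pre) = ⊥-elim (Started⇒no-Pre-consumption st u∉J en pre consumes)
  ... | inj₂ (inj₂ post) = post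

  Progress : Marking 𝒩 → Set
  Progress M = (∃[ y ] BlockConsumed y × 1 ≤ M y) ⊎ (∀ q → Post q → 1 ≤ M q)

  Progress-block-step : ∀ {M v} → InBlock v → Progress (fire 𝒩 M v)
  Progress-block-step {M} {v} v∈J with ∃-output wf v
  ... | q , produces with block-output v∈J produces
  ...   | inj₁ post = inj₂ λ q' post' → fire-marks M (subst T (Post-outArc-≡ post post' v∈J) produces)
  ...   | inj₂ consumed = inj₁ (q , consumed , fire-marks M produces)

  Progress-≐ : ∀ {M M'} → _≐_ 𝒩 M' M → Progress M → Progress M'
  Progress-≐ M'≐M (inj₁ (y , c , marked)) = inj₁ (y , c , ≤-trans marked (≤-reflexive (sym (M'≐M y))))
  Progress-≐ M'≐M (inj₂ all) = inj₂ λ q post → ≤-trans (all q post) (≤-reflexive (sym (M'≐M q)))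

  module PostConsumed (needed : T needE) {M} (started-M : Started M) (Post-marked : ∀ q → Post q → 1 ≤ M q)
                      {x} (x-consumed : BlockConsumed x) (x-marked : 1 ≤ M x) where

    -- Mσ follows a run from M, while Mo replays on top of M only its outside steps that consume no Post place.
    record Hybrid (Mσ Mo : Marking 𝒩) : Set where
      field
        started-σ : Started Mσ
        started-o : Started Mo
        inside    : ∀ q → T (touches j q) → Mo q ≡ M q
        outside   : ∀ q → ¬ T (touches j q) → Mo q ≡ Mσ q
        progress  : Progress Mσ

    Hybrid-block-step : ∀ {Mσ Mσ' Mo v} → Hybrid Mσ Mo → (en : Enabled 𝒩 Mσ v) → _≐_ 𝒩 Mσ' (fire 𝒩 Mσ v) →
                        InBlock v → Hybrid Mσ' Mo
    Hybrid-block-step {Mσ} {Mσ'} {Mo} {v} H en fired v∈J = record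
      { started-σ = Started-step started-σ (v , en , fired)
      ; started-o = started-o
      ; inside = inside
      ; outside = λ q untouched → trans (outside q untouched) (sym (trans (fired q)
                    (fire-idle Mσ (¬T⇒≡false λ c → untouched (touches⁺-in v∈J c))
                                  (¬T⇒≡false λ o → untouched (touches⁺-out v∈J o)))))
      ; progress = Progress-≐ fired (Progress-block-step v∈J)
      }
      where open Hybrid H

    Hybrid-enabled : ∀ {Mσ Mo v} → Hybrid Mσ Mo → Enabled 𝒩 Mσ v → ¬ InBlock v → Enabled 𝒩 Mo v
    Hybrid-enabled H en v∉J q consumes with T? (touches j q)
    ... | yes touching = ≤-trans (Post-marked q (Started⇒outside-touching-input-Post started-σ v∉J en consumes touching))
                                 (≤-reflexive (sym (inside q touching)))
      where open Hybrid H
    ... | no untouched = ≤-trans (en q consumes) (≤-reflexive (sym (outside q untouched)))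
      where open Hybrid H

    Hybrid-outside-step : ∀ {Mσ Mσ' Mo v} → Hybrid Mσ Mo → (en : Enabled 𝒩 Mσ v) → _≐_ 𝒩 Mσ' (fire 𝒩 Mσ v) →
                          ¬ InBlock v → (∀ q → Post q → ¬ T (inArc q v)) → Hybrid Mσ' (fire 𝒩 Mo v)
    Hybrid-outside-step {Mσ} {Mσ'} {Mo} {v} H en fired v∉J Post-unconsumed = record
      { started-σ = Started-step started-σ (v , en , fired)
      ; started-o = Started-step started-o (step-fire hybrid-enabled)
      ; inside = λ q touching → trans (fire-idle Mo (untouched-input touching) (untouched-output touching)) (inside q touching)
      ; outside = λ q untouched → trans (fire-cong Mo Mσ (outside q untouched)) (sym (fired q))
      ; progress = Progress-≐ fired (progress′ progress)
      }
      where
      open Hybrid H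
      untouched-input : ∀ {q} → T (touches j q) → inArc q v ≡ false
      untouched-input touching = ¬T⇒≡false λ consumes →
        Post-unconsumed _ (Started⇒outside-touching-input-Post started-σ v∉J en consumes touching) consumes
      hybrid-enabled : Enabled 𝒩 Mo v
      hybrid-enabled = Hybrid-enabled H en v∉J
      untouched-output : ∀ {q} → T (touches j q) → outArc v q ≡ false
      untouched-output touching with touches-cases touching
      ... | inj₁ inner = Started⇒outside-unproduced started-o v∉J hybrid-enabled (inj₂ (Inner⇒BlockProduced inner))
      ... | inj₂ (inj₁ pre) = Started⇒outside-unproduced started-o v∉J hybrid-enabled (inj₁ pre)
      ... | inj₂ (inj₂ post) =
        Started⇒outside-unproduced started-o v∉J hybrid-enabled (inj₂ (needE⇒Post-BlockProduced needed post))
      progress′ : Progress Mσ → Progress (fire 𝒩 Mσ v)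
      progress′ (inj₁ (y , c , marked)) =
        inj₁ (y , c , ≤-trans marked (fire-≥ Mσ (¬T⇒≡false λ consumes → v∉J (proj₂ c v consumes))))
      progress′ (inj₂ all) = inj₂ λ q post → ≤-trans (all q post) (fire-≥ Mσ (¬T⇒≡false (Post-unconsumed q post)))

    -- An outside transition consuming a Post place q₁ can be fired in Mo, where the block has
    -- already produced all its outputs but still holds the token on x: a leftover situation.
    Hybrid-outside-Post-consumption : ∀ {Mσ Mo v q₁} → Hybrid Mσ Mo → Enabled 𝒩 Mσ v → ¬ InBlock v →
                                      Post q₁ → T (inArc q₁ v) → ⊥
    Hybrid-outside-Post-consumption {Mσ} {Mo} {v} {q₁} H en v∉J post₁ consumes₁ =
      Leftover⇒¬final leftover (proj₁ (proj₂ completion)) (proj₂ (proj₂ completion))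
      where
      open Hybrid H
      enabled : Enabled 𝒩 Mo v
      enabled = Hybrid-enabled H en v∉J
      started-o′ : Started (fire 𝒩 Mo v)
      started-o′ = Started-step started-o (step-fire enabled)
      completion = Sound.option sound _ (Started.reachable-now started-o′)
      unproduced : ∀ {q} → Pre q ⊎ BlockProduced q → outArc v q ≡ false
      unproduced = Started⇒outside-unproduced started-o v∉J enabled
      touching : ∀ {q} → Pre q ⊎ BlockProduced q → T (touches j q)
      touching (inj₁ pre) = Pre-touches pre
      touching (inj₂ produced) = BlockProduced-touches produced
      produced₁ : BlockProduced q₁
      produced₁ = needE⇒Post-BlockProduced needed post₁
      leftover : Leftover (fire 𝒩 Mo v) M q₁
      leftover = record
        { started = started-o′
        ; dominating = Started.reachable-now started-M
        ; dominated = λ q c → ≤-trans (fire-≤ Mo (unproduced c)) (≤-reflexive (inside q (touching c)))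
        ; q₀-Post = post₁
        ; q₀-marked = Post-marked q₁ post₁
        ; q₀-unconsumable = inj₂ (produced₁ , fire-empties Mo (to T-≡ consumes₁) (unproduced (inj₂ produced₁))
                                                 (safe Mo (Started.reachable-now started-o) q₁))
        ; leftover = x , x-consumed , ≤-trans x-marked (≤-trans (≤-reflexive (sym (inside x (BlockConsumed-touches x-consumed))))
                                          (fire-≥ Mo (¬T⇒≡false λ consumes → v∉J (proj₂ x-consumed v consumes))))
        }

    Hybrid⇒¬final : ∀ {Mσ Mo Mf} → Hybrid Mσ Mo → Reach 𝒩 Mσ Mf → ¬ _≐_ 𝒩 Mf (⟦_⟧ 𝒩 oN)
    Hybrid⇒¬final H ε final with Hybrid.progress H
    ... | inj₁ (y , (y≢o , _) , y-marked) = final-unmarked final y≢o y-marked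
    ... | inj₂ all with some-Post
    ...   | q , post with needE⇒Post-consumed needed post
    ...     | _ , _ , consumes = final-unmarked final (consumed⇒≢oN wf consumes) (all q post)
    Hybrid⇒¬final H ((v , en , fired) ◅ run) with part v ≟F j
    ... | yes v∈J = Hybrid⇒¬final (Hybrid-block-step H en fired v∈J) run
    ... | no v∉J with any? (λ q → T? (isPost j q) ×-dec T? (inArc q v))
    ...   | yes (q , post , consumes) = λ _ → Hybrid-outside-Post-consumption H en v∉J post consumes
    ...   | no none = Hybrid⇒¬final (Hybrid-outside-step H en fired v∉J λ q post consumes → none (q , post , consumes)) run

  Post-marked⇒BlockConsumed-empty : ∀ {M} → Started M → (∀ q → Post q → 1 ≤ M q) → ∀ {x} → BlockConsumed x → M x ≡ 0
  Post-marked⇒BlockConsumed-empty {M} st Post-marked {x} x-consumed = n≤0⇒n≡0 (≮⇒≥ unmarked)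
    where
    unmarked : ¬ (1 ≤ M x)
    unmarked x-marked with Sound.option sound M (Started.reachable-now st) | T? needE
    ... | Mf , run , final | yes needed =
      PostConsumed.Hybrid⇒¬final needed st Post-marked x-consumed x-marked
        (record { started-σ = st ; started-o = st ; inside = λ _ _ → refl ; outside = λ _ _ → refl
                ; progress = inj₁ (x , x-consumed , x-marked) }) run final
    ... | Mf , run , final | no ¬needed =
      Leftover⇒¬final (record
        { started = st
        ; dominating = Started.reachable-now st
        ; dominated = λ _ _ → ≤-refl
        ; q₀-Post = proj₂ some-Post
        ; q₀-marked = Post-marked _ (proj₂ some-Post)
        ; q₀-unconsumable = inj₁ λ t t∈J → ¬needE⇒Post-unconsumed ¬needed (proj₂ some-Post) t∈J
        ; leftover = x , x-consumed , x-marked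
        }) run final

  initial-idle : BlockIdle (⟦_⟧ 𝒩 iN)
  initial-idle q (q≢i , _) = ⟦⟧-other q≢i

  idle-or-started : ∀ {Y Z} → Reachable Y → BlockIdle Y → Reach 𝒩 Y Z → BlockIdle Z ⊎ Started Z
  idle-or-started reachable idle ε = inj₁ idle
  idle-or-started {Y} reachable idle (_◅_ {j = Y′} (v , en , fired) run) with part v ≟F j
  ... | yes v∈J = inj₂ (record { ready = record { reachable = reachable ; idle = idle ; first = v ; first∈J = v∈J ; enabled = en }
                               ; fired = fired ; run = run })
  ... | no v∉J = idle-or-started (reachable ◅◅ (v , en , fired) ◅ ε) idle′ run
    where
    idle′ : BlockIdle Y′
    idle′ q produced = trans (fired q) (fire-keeps-empty Y (idle q produced) (¬T⇒≡false λ o → v∉J (proj₂ produced v o)))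

  enabled⇒Ready-or-Started : ∀ {Z t} → Reachable Z → InBlock t → Enabled 𝒩 Z t → Ready Z ⊎ Started Z
  enabled⇒Ready-or-Started {t = t} reachable t∈J en with idle-or-started ε initial-idle reachable
  ... | inj₁ idle = inj₁ (record { reachable = reachable ; idle = idle ; first = t ; first∈J = t∈J ; enabled = en })
  ... | inj₂ st = inj₂ st

  some-Ready : ∃[ X ] Ready X
  some-Ready with Sound.no-dead sound t₀
  ... | Z , reachable , en with enabled⇒Ready-or-Started reachable t₀∈J en
  ...   | inj₁ ready = Z , ready
  ...   | inj₂ st = _ , Started.ready st

  Post-marked⇒Pre-empty : ∀ {M} → Started M → (∀ q → Post q → 1 ≤ M q) → ∀ {p} → Pre p → M p ≡ 0
  Post-marked⇒Pre-empty st Post-marked {p} pre with any? (λ t → part t ≟F j ×-dec T? (outArc t p))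
  ... | yes (t , t∈J , produces) = Post-marked⇒BlockConsumed-empty st Post-marked (Pre-produced⇒BlockConsumed pre t∈J produces)
  ... | no unfed = Started-Pre-unfed-empty st pre λ t t∈J produces → unfed (t , t∈J , produces)

module ProjectionStructure {A : Set} {m k n : ℕ} (N : FinNet A m k) (part : Fin k → Fin n)
                           (wf : IsWF (toNet N)) (po : PO.IsPOPattern N part) (j : Fin n) where
  open FinNet N
  open PO N part
  open BlockOrder N part using (isPre-intro)
  open Block N part wf po j
  open NetProperties (toNet N)
  open Projection N part j

  source-cases : ∀ (b : Bool) (f : T b → PPlace) (d : PPlace) →
                 (∃[ w ] source b f d ≡ f w) ⊎ (b ≡ false × source b f d ≡ d)
  source-cases true f d = inj₁ (tt , refl)
  source-cases false f d = inj₂ (refl , refl)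

  𝒩 𝒩ⱼ : Net A
  𝒩 = toNet N
  𝒩ⱼ = poproject N part j

  data Image : Node 𝒩 → Node 𝒩ⱼ → Set where
    transition : ∀ {t} (t∈J : InBlock t) → Image (tr t) (tr (orig t t∈J))
    inner-place : ∀ {q} (i : Inner q) → Image (pl q) (pl (inner q i))
    Pre-place : ∀ {q} → Pre q → Image (pl q) (pl ps)
    Post-place : ∀ {q} → Post q → Image (pl q) (pl pe)

  image-in : ∀ {q x t} (t∈J : InBlock t) → T (inArc q t) → Image (pl q) (pl x) → Edge 𝒩ⱼ (pl x) (tr (orig t t∈J))
  image-in t∈J consumes (inner-place _) = consumes
  image-in t∈J consumes (Pre-place pre) = subst T (sym (fromS≡inArc pre t∈J)) consumes
  image-in t∈J consumes (Post-place post) = subst T (sym (fromE≡inArc post t∈J)) consumes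

  image-out : ∀ {q x t} (t∈J : InBlock t) → T (outArc t q) → Image (pl q) (pl x) → Edge 𝒩ⱼ (tr (orig t t∈J)) (pl x)
  image-out t∈J produces (inner-place _) = produces
  image-out t∈J produces (Pre-place pre) = subst T (sym (toS≡outArc pre t∈J)) produces
  image-out t∈J produces (Post-place post) = subst T (sym (toE≡outArc post t∈J)) produces

  image-arc : ∀ {q x u t} (u∈J : InBlock u) (t∈J : InBlock t) → T (outArc u q) → T (inArc q t) →
              Image (pl q) (pl x) → Star (Edge 𝒩ⱼ) (tr (orig u u∈J)) (tr (orig t t∈J))
  image-arc {x = x} u∈J t∈J produces consumes image =
    _◅_ {j = pl x} (image-out u∈J produces image) (image-in t∈J consumes image ◅ ε)

  image-touching : ∀ {q} → T (touches j q) → ∃[ x ] Image (pl q) (pl x)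
  image-touching touching with touches-cases touching
  ... | inj₁ i = _ , inner-place i
  ... | inj₂ (inj₁ pre) = _ , Pre-place pre
  ... | inj₂ (inj₂ post) = _ , Post-place post

  -- Walking back from a block transition, the path stays in the image until it enters the
  -- block through a Pre place.
  lift-to-block : ∀ {a t} (t∈J : InBlock t) → Star (Edge 𝒩) a (tr t) →
                  (∃[ a' ] Image a a' × Star (Edge 𝒩ⱼ) a' (tr (orig t t∈J))) ⊎ Star (Edge 𝒩ⱼ) (pl ps) (tr (orig t t∈J))
  lift-to-block t∈J ε = inj₁ (_ , transition t∈J , ε)
  lift-to-block t∈J (_◅_ {i = pl _} {j = tr t₁} consumes path) with lift-to-block t∈J path
  ... | inj₂ from-ps = inj₂ from-ps
  ... | inj₁ (_ , transition t₁∈J , path′) with image-touching (touches⁺-in t₁∈J consumes)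
  ...   | _ , image = inj₁ (_ , image , image-in t₁∈J consumes image ◅ path′)
  lift-to-block t∈J (_◅_ {i = tr u} {j = pl _} produces (_◅_ {j = tr t₁} consumes path)) with lift-to-block t∈J path
  ... | inj₂ from-ps = inj₂ from-ps
  ... | inj₁ (_ , transition t₁∈J , path′) with part u ≟F j
  ...   | no u∉J = inj₂ (image-in t₁∈J consumes (Pre-place pre) ◅ path′)
    where pre = isPre-intro t₁∈J consumes (inj₂ (u , u∉J , produces))
  ...   | yes u∈J with image-touching (touches⁺-in t₁∈J consumes)
  ...     | _ , image = inj₁ (_ , transition u∈J , image-arc u∈J t₁∈J produces consumes image ◅◅ path′)
  lift-to-block t∈J (_◅_ {i = tr _} {j = pl _} _ (_◅_ {j = pl _} () _))
  lift-to-block t∈J (_◅_ {i = pl _} {j = pl _} () _)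
  lift-to-block t∈J (_◅_ {i = tr _} {j = tr _} () _)

  ps-reaches-block : ∀ {t} (t∈J : InBlock t) → Star (Edge 𝒩ⱼ) (pl ps) (tr (orig t t∈J))
  ps-reaches-block {t} t∈J with lift-to-block t∈J (proj₁ (IsWF.on-path wf (tr t)))
  ... | inj₂ from-ps = from-ps
  ... | inj₁ (_ , Pre-place _ , path) = path
  ... | inj₁ (_ , inner-place i , _) = ⊥-elim (proj₁ (Inner⇒BlockProduced i) refl)
  ... | inj₁ (_ , Post-place post , _) with Post⇒producer post
  ...   | _ , _ , produces = ⊥-elim (produced⇒≢iN wf produces refl)

  block-reaches-pe : ∀ {t} (t∈J : InBlock t) → Star (Edge 𝒩) (tr t) (pl oN) → Star (Edge 𝒩ⱼ) (tr (orig t t∈J)) (pl pe)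
  block-reaches-pe t∈J (_◅_ {j = pl _} produces path) with block-output t∈J produces
  ... | inj₁ post = image-out t∈J produces (Post-place post) ◅ ε
  ... | inj₂ consumed with image-touching (BlockConsumed-touches consumed) | path
  ...   | _ , Post-place post | _ = image-out t∈J produces (Post-place post) ◅ ε
  ...   | _ , image | ε = ⊥-elim (proj₁ consumed refl)
  ...   | _ , image | _◅_ {j = tr t'} consumes path′ =
    image-arc t∈J t'∈J produces consumes image ◅◅ block-reaches-pe t'∈J path′
    where t'∈J = proj₂ consumed t' consumes
  ...   | _ , image | _◅_ {j = pl _} () _
  block-reaches-pe t∈J (_◅_ {j = tr _} () _)

  iⱼ oⱼ : PPlace
  iⱼ = Net.iN 𝒩ⱼ
  oⱼ = Net.oN 𝒩ⱼ

  iⱼ-cases : (∃[ w ] iⱼ ≡ ps' w) ⊎ (¬ T needS × iⱼ ≡ ps)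
  iⱼ-cases with source-cases needS ps' ps
  ... | inj₁ w,e = inj₁ w,e
  ... | inj₂ (absent , e) = inj₂ (subst T absent , e)

  oⱼ-cases : (∃[ w ] oⱼ ≡ pe' w) ⊎ (¬ T needE × oⱼ ≡ pe)
  oⱼ-cases with source-cases needE pe' pe
  ... | inj₁ w,e = inj₁ w,e
  ... | inj₂ (absent , e) = inj₂ (subst T absent , e)

  iⱼ≡ps' : ∀ w → iⱼ ≡ ps' w
  iⱼ≡ps' w with iⱼ-cases
  ... | inj₁ (w' , e) = trans e (cong ps' (T-irrelevant w' w))
  ... | inj₂ (absent , _) = ⊥-elim (absent w)

  oⱼ≡pe' : ∀ w → oⱼ ≡ pe' w
  oⱼ≡pe' w with oⱼ-cases
  ... | inj₁ (w' , e) = trans e (cong pe' (T-irrelevant w' w))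
  ... | inj₂ (absent , _) = ⊥-elim (absent w)

  iⱼ-reaches-ps : Star (Edge 𝒩ⱼ) (pl iⱼ) (pl ps)
  iⱼ-reaches-ps with iⱼ-cases
  ... | inj₁ (w , e) = subst (λ x → Star (Edge 𝒩ⱼ) (pl x) (pl ps)) (sym e) (_◅_ {j = tr (ts w)} tt (tt ◅ ε))
  ... | inj₂ (_ , e) = subst (λ x → Star (Edge 𝒩ⱼ) (pl x) (pl ps)) (sym e) ε

  pe-reaches-oⱼ : Star (Edge 𝒩ⱼ) (pl pe) (pl oⱼ)
  pe-reaches-oⱼ with oⱼ-cases
  ... | inj₁ (w , e) = subst (λ x → Star (Edge 𝒩ⱼ) (pl pe) (pl x)) (sym e) (_◅_ {j = tr (te w)} tt (tt ◅ ε))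
  ... | inj₂ (_ , e) = subst (λ x → Star (Edge 𝒩ⱼ) (pl pe) (pl x)) (sym e) ε

  ps-reaches-pe : Star (Edge 𝒩ⱼ) (pl ps) (pl pe)
  ps-reaches-pe with Pre⇒consumer (proj₂ some-Pre)
  ... | t , t∈J , consumes =
    image-in t∈J consumes (Pre-place (proj₂ some-Pre)) ◅ block-reaches-pe t∈J (proj₂ (IsWF.on-path wf (tr t)))

  from-iⱼ : ∀ x → Star (Edge 𝒩ⱼ) (pl iⱼ) x
  from-iⱼ (tr (orig t t∈J)) = iⱼ-reaches-ps ◅◅ ps-reaches-block t∈J
  from-iⱼ (tr (ts w)) = subst (λ x → Star (Edge 𝒩ⱼ) (pl x) (tr (ts w))) (sym (iⱼ≡ps' w)) (tt ◅ ε)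
  from-iⱼ (tr (te w)) = iⱼ-reaches-ps ◅◅ ps-reaches-pe ◅◅ tt ◅ ε
  from-iⱼ (pl (inner q i)) with ∃-producer wf (proj₁ (Inner⇒BlockProduced i))
  ... | t , produces = iⱼ-reaches-ps ◅◅ ps-reaches-block t∈J ◅◅ image-out t∈J produces (inner-place i) ◅ ε
    where t∈J = proj₂ (Inner⇒BlockProduced i) t produces
  from-iⱼ (pl ps) = iⱼ-reaches-ps
  from-iⱼ (pl pe) = iⱼ-reaches-ps ◅◅ ps-reaches-pe
  from-iⱼ (pl (ps' w)) = subst (λ x → Star (Edge 𝒩ⱼ) (pl x) (pl (ps' w))) (sym (iⱼ≡ps' w)) ε
  from-iⱼ (pl (pe' w)) = iⱼ-reaches-ps ◅◅ ps-reaches-pe ◅◅ _◅_ {j = tr (te w)} tt (tt ◅ ε)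

  to-oⱼ : ∀ x → Star (Edge 𝒩ⱼ) x (pl oⱼ)
  to-oⱼ (tr (orig t t∈J)) = block-reaches-pe t∈J (proj₂ (IsWF.on-path wf (tr t))) ◅◅ pe-reaches-oⱼ
  to-oⱼ (tr (ts w)) = tt ◅ ps-reaches-pe ◅◅ pe-reaches-oⱼ
  to-oⱼ (tr (te w)) = subst (λ x → Star (Edge 𝒩ⱼ) (tr (te w)) (pl x)) (sym (oⱼ≡pe' w)) (tt ◅ ε)
  to-oⱼ (pl (inner q i)) with ∃-consumer wf (proj₁ (Inner⇒BlockConsumed i))
  ... | t , consumes =
    image-in t∈J consumes (inner-place i) ◅ block-reaches-pe t∈J (proj₂ (IsWF.on-path wf (tr t))) ◅◅ pe-reaches-oⱼ
    where t∈J = proj₂ (Inner⇒BlockConsumed i) t consumes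
  to-oⱼ (pl ps) = ps-reaches-pe ◅◅ pe-reaches-oⱼ
  to-oⱼ (pl pe) = pe-reaches-oⱼ
  to-oⱼ (pl (ps' w)) = _◅_ {j = tr (ts w)} tt (tt ◅ ps-reaches-pe ◅◅ pe-reaches-oⱼ)
  to-oⱼ (pl (pe' w)) = subst (λ x → Star (Edge 𝒩ⱼ) (pl (pe' w)) (pl x)) (sym (oⱼ≡pe' w)) ε

  unproduced-contra : ∀ x t → NoPre 𝒩ⱼ x → ¬ Edge 𝒩ⱼ (tr t) (pl x)
  unproduced-contra x t none = subst T (none t)

  unconsumed-contra : ∀ x t → NoPost 𝒩ⱼ x → ¬ Edge 𝒩ⱼ (pl x) (tr t)
  unconsumed-contra x t none = subst T (none t)

  only-source : ∀ x → NoPre 𝒩ⱼ x → x ≡ iⱼ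
  only-source (inner q i) none with ∃-producer wf (proj₁ (Inner⇒BlockProduced i))
  ... | t , produces = ⊥-elim (unproduced-contra (inner q i) (orig t t∈J) none (image-out t∈J produces (inner-place i)))
    where t∈J = proj₂ (Inner⇒BlockProduced i) t produces
  only-source ps none with iⱼ-cases
  ... | inj₂ (_ , e) = sym e
  ... | inj₁ (w , _) with in-block⁻ toS w
  ...   | t , t∈J , toS-t = ⊥-elim (unproduced-contra ps (orig t t∈J) none toS-t)
  only-source pe none with Post⇒producer (proj₂ some-Post)
  ... | t , t∈J , produces =
    ⊥-elim (unproduced-contra pe (orig t t∈J) none (image-out t∈J produces (Post-place (proj₂ some-Post))))
  only-source (ps' w) none = sym (iⱼ≡ps' w)
  only-source (pe' w) none = ⊥-elim (unproduced-contra (pe' w) (te w) none tt)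

  only-sink : ∀ x → NoPost 𝒩ⱼ x → x ≡ oⱼ
  only-sink (inner q i) none with ∃-consumer wf (proj₁ (Inner⇒BlockConsumed i))
  ... | t , consumes = ⊥-elim (unconsumed-contra (inner q i) (orig t t∈J) none (image-in t∈J consumes (inner-place i)))
    where t∈J = proj₂ (Inner⇒BlockConsumed i) t consumes
  only-sink ps none with Pre⇒consumer (proj₂ some-Pre)
  ... | t , t∈J , consumes = ⊥-elim (unconsumed-contra ps (orig t t∈J) none (image-in t∈J consumes (Pre-place (proj₂ some-Pre))))
  only-sink pe none with oⱼ-cases
  ... | inj₂ (_ , e) = sym e
  ... | inj₁ (w , _) with in-block⁻ fromE w
  ...   | t , t∈J , fromE-t = ⊥-elim (unconsumed-contra pe (orig t t∈J) none fromE-t)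
  only-sink (ps' w) none = ⊥-elim (unconsumed-contra (ps' w) (ts w) none tt)
  only-sink (pe' w) none = sym (oⱼ≡pe' w)

  iⱼ-source : NoPre 𝒩ⱼ iⱼ
  iⱼ-source t with iⱼ-cases
  ... | inj₁ (w , e) = subst (λ x → pOut t x ≡ false) (sym e) (ps'-unproduced t)
    where
    ps'-unproduced : ∀ t → pOut t (ps' w) ≡ false
    ps'-unproduced (orig _ _) = refl
    ps'-unproduced (ts _) = refl
    ps'-unproduced (te _) = refl
  ... | inj₂ (absent , e) = subst (λ x → pOut t x ≡ false) (sym e) (ps-unproduced t)
    where
    ps-unproduced : ∀ t → pOut t ps ≡ false
    ps-unproduced (orig t t∈J) = ¬T⇒≡false λ toS-t → absent (in-block⁺ toS t∈J toS-t)
    ps-unproduced (ts w) = ⊥-elim (absent w)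
    ps-unproduced (te _) = refl

  oⱼ-sink : NoPost 𝒩ⱼ oⱼ
  oⱼ-sink t with oⱼ-cases
  ... | inj₁ (w , e) = subst (λ x → pIn x t ≡ false) (sym e) (pe'-unconsumed t)
    where
    pe'-unconsumed : ∀ t → pIn (pe' w) t ≡ false
    pe'-unconsumed (orig _ _) = refl
    pe'-unconsumed (ts _) = refl
    pe'-unconsumed (te _) = refl
  ... | inj₂ (absent , e) = subst (λ x → pIn x t ≡ false) (sym e) (pe-unconsumed t)
    where
    pe-unconsumed : ∀ t → pIn pe t ≡ false
    pe-unconsumed (orig t t∈J) = ¬T⇒≡false λ fromE-t → absent (in-block⁺ fromE t∈J fromE-t)
    pe-unconsumed (ts _) = refl
    pe-unconsumed (te w) = ⊥-elim (absent w)

  projection-WF : IsWF 𝒩ⱼ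
  projection-WF = record
    { source-only-i = only-source
    ; i-source = iⱼ-source
    ; sink-only-o = only-sink
    ; o-sink = oⱼ-sink
    ; on-path = λ x → from-iⱼ x , to-oⱼ x
    }

optional : (b : Bool) → (T b → ℕ) → ℕ
optional true f = f tt
optional false _ = 0

optional-present : ∀ {b} (f : T b → ℕ) w → optional b f ≡ f w
optional-present {true} f tt = refl

optional-absent : ∀ {b} (f : T b → ℕ) → ¬ T b → optional b f ≡ 0
optional-absent {true} f absent = ⊥-elim (absent tt)
optional-absent {false} f absent = refl

optional-zero : ∀ b → optional b (λ _ → 0) ≡ 0
optional-zero true = refl
optional-zero false = refl

optional-cong : ∀ {b} {f g : T b → ℕ} → (∀ w → f w ≡ g w) → optional b f ≡ optional b g
optional-cong {true} f≡g = f≡g tt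
optional-cong {false} f≡g = refl

module ProjectionRuns {A : Set} {m k n : ℕ} (N : FinNet A m k) (part : Fin k → Fin n)
                      (wf : IsWF (toNet N)) (safe : Safe (toNet N)) (sound : Sound (toNet N))
                      (po : PO.IsPOPattern N part) (j : Fin n) where
  open FinNet N
  open PO N part
  open Block N part wf po j
  open NetProperties (toNet N)
  open BlockRuns N part wf safe sound po j hiding (𝒩)
  open Projection N part j
  open ProjectionStructure N part wf po j
  module ℙ = NetProperties 𝒩ⱼ

  initialⱼ : Marking 𝒩ⱼ
  initialⱼ = ⟦_⟧ 𝒩ⱼ iⱼ

  ps'-tokens pe'-tokens start-tokens end-tokens : Marking 𝒩ⱼ → ℕ
  ps'-tokens M' = optional needS (λ w → M' (ps' w))
  pe'-tokens M' = optional needE (λ w → M' (pe' w))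
  start-tokens M' = M' ps + ps'-tokens M'
  end-tokens M' = M' pe + pe'-tokens M'

  initial-elsewhere : ∀ x → x ≢ ps → (∀ w → x ≢ ps' w) → initialⱼ x ≡ 0
  initial-elsewhere x x≢ps x≢ps' with iⱼ-cases
  ... | inj₁ (w , e) = trans (cong (λ y → ⟦_⟧ 𝒩ⱼ y x) e) (ℙ.⟦⟧-other (x≢ps' w))
  ... | inj₂ (_ , e) = trans (cong (λ y → ⟦_⟧ 𝒩ⱼ y x) e) (ℙ.⟦⟧-other x≢ps)

  initial-start-tokens : start-tokens initialⱼ ≡ 1
  initial-start-tokens with iⱼ-cases
  ... | inj₁ (w , e) = begin
        initialⱼ ps + ps'-tokens initialⱼ ≡⟨ cong₂ _+_ (trans (cong (λ y → ⟦_⟧ 𝒩ⱼ y ps) e) (ℙ.⟦⟧-other {ps} {ps' w} λ ()))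
                                                     (optional-present _ w) ⟩
        initialⱼ (ps' w)                  ≡⟨ subst (λ y → ⟦_⟧ 𝒩ⱼ y (ps' w) ≡ 1) (sym e) (ℙ.⟦⟧-self (ps' w)) ⟩
        1                                 ∎
    where open ≡-Reasoning
  ... | inj₂ (absent , e) = begin
        initialⱼ ps + ps'-tokens initialⱼ ≡⟨ cong₂ _+_ (subst (λ y → ⟦_⟧ 𝒩ⱼ y ps ≡ 1) (sym e) (ℙ.⟦⟧-self ps))
                                                     (optional-absent _ absent) ⟩
        1                                 ∎
    where open ≡-Reasoning

  initial-end-tokens : end-tokens initialⱼ ≡ 0
  initial-end-tokens = cong₂ _+_ (initial-elsewhere pe (λ ()) (λ _ ()))
                                 (trans (optional-cong λ w → initial-elsewhere (pe' w) (λ ()) (λ _ ())) (optional-zero needE))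

  fire-image : ∀ {M' q x v} (v∈J : InBlock v) → Image (pl q) (pl x) →
               fire 𝒩ⱼ M' (orig v v∈J) x ≡ fire 𝒩 (λ _ → M' x) v q
  fire-image v∈J (inner-place _) = refl
  fire-image {M'} v∈J (Pre-place pre) =
    cong₂ (λ a b → (M' ps ∸ (if a then 1 else 0)) + (if b then 1 else 0)) (fromS≡inArc pre v∈J) (toS≡outArc pre v∈J)
  fire-image {M'} v∈J (Post-place post) =
    cong₂ (λ a b → (M' pe ∸ (if a then 1 else 0)) + (if b then 1 else 0)) (fromE≡inArc post v∈J) (toE≡outArc post v∈J)

  ps'-tokens-orig : ∀ {M' v} (v∈J : InBlock v) → ps'-tokens (fire 𝒩ⱼ M' (orig v v∈J)) ≡ ps'-tokens M'
  ps'-tokens-orig {M'} _ = optional-cong λ w → +-identityʳ (M' (ps' w))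

  pe'-tokens-orig : ∀ {M' v} (v∈J : InBlock v) → pe'-tokens (fire 𝒩ⱼ M' (orig v v∈J)) ≡ pe'-tokens M'
  pe'-tokens-orig {M'} _ = optional-cong λ w → +-identityʳ (M' (pe' w))

  start-tokens-orig : ∀ {M' v p} (v∈J : InBlock v) → Pre p → Enabled 𝒩ⱼ M' (orig v v∈J) →
                      start-tokens (fire 𝒩ⱼ M' (orig v v∈J)) ≡ fire 𝒩 (λ _ → start-tokens M') v p
  start-tokens-orig {M'} {v} {p} v∈J pre en = begin
    start-tokens (fire 𝒩ⱼ M' (orig v v∈J))     ≡⟨ cong (fire 𝒩ⱼ M' (orig v v∈J) ps +_) (ps'-tokens-orig {M'} v∈J) ⟩
    fire 𝒩ⱼ M' (orig v v∈J) ps + ps'-tokens M' ≡⟨ cong (_+ ps'-tokens M') (fire-image {M'} v∈J (Pre-place pre)) ⟩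
    fire 𝒩 (λ _ → M' ps) v p + ps'-tokens M'   ≡⟨ [m∸o+p]+n≡[m+n∸o]+p (M' ps) (ps'-tokens M') _ _ ps-enough ⟩
    fire 𝒩 (λ _ → start-tokens M') v p         ∎
    where
    open ≡-Reasoning
    ps-enough = arc-weight-≤ λ consumes → en ps (image-in v∈J consumes (Pre-place pre))

  end-tokens-orig : ∀ {M' v q} (v∈J : InBlock v) → Post q → Enabled 𝒩ⱼ M' (orig v v∈J) →
                    end-tokens (fire 𝒩ⱼ M' (orig v v∈J)) ≡ fire 𝒩 (λ _ → end-tokens M') v q
  end-tokens-orig {M'} {v} {q} v∈J post en = begin
    end-tokens (fire 𝒩ⱼ M' (orig v v∈J))       ≡⟨ cong (fire 𝒩ⱼ M' (orig v v∈J) pe +_) (pe'-tokens-orig {M'} v∈J) ⟩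
    fire 𝒩ⱼ M' (orig v v∈J) pe + pe'-tokens M' ≡⟨ cong (_+ pe'-tokens M') (fire-image {M'} v∈J (Post-place post)) ⟩
    fire 𝒩 (λ _ → M' pe) v q + pe'-tokens M'   ≡⟨ [m∸o+p]+n≡[m+n∸o]+p (M' pe) (pe'-tokens M') _ _ pe-enough ⟩
    fire 𝒩 (λ _ → end-tokens M') v q           ∎
    where
    open ≡-Reasoning
    pe-enough = arc-weight-≤ λ consumes → en pe (image-in v∈J consumes (Post-place post))

  start-tokens-≐ : ∀ {M' M''} → _≐_ 𝒩ⱼ M'' M' → start-tokens M'' ≡ start-tokens M'
  start-tokens-≐ e = cong₂ _+_ (e ps) (optional-cong λ w → e (ps' w))

  end-tokens-≐ : ∀ {M' M''} → _≐_ 𝒩ⱼ M'' M' → end-tokens M'' ≡ end-tokens M'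
  end-tokens-≐ e = cong₂ _+_ (e pe) (optional-cong λ w → e (pe' w))

  ps'-tokens-≐ : ∀ {M' M''} → _≐_ 𝒩ⱼ M'' M' → ps'-tokens M'' ≡ ps'-tokens M'
  ps'-tokens-≐ e = optional-cong λ w → e (ps' w)

  -- Until the block starts, the start token of the projection may still sit on ps'.
  record Simulated (M' : Marking 𝒩ⱼ) (M : Marking 𝒩) : Set where
    field
      inner-≡ : ∀ p (i : Inner p) → M' (inner p i) ≡ M p
      start-≡ : ∀ p → Pre p → start-tokens M' ≡ M p
      end-≤   : ∀ q → Post q → end-tokens M' ≤ M q
      end-≡   : T needE → ∀ q → Post q → M q ≡ end-tokens M'
      phase   : (Ready M × end-tokens M' ≡ 0) ⊎ (Started M × ps'-tokens M' ≡ 0)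

    reachable : Reachable M
    reachable with phase
    ... | inj₁ (ready , _) = Ready.reachable ready
    ... | inj₂ (st , _) = Started.reachable-now st

  initial-Simulated : ∀ {X} → Ready X → Simulated initialⱼ X
  initial-Simulated ready = record
    { inner-≡ = λ p i → trans (initial-elsewhere (inner p i) (λ ()) (λ _ ())) (sym (idle p (Inner⇒BlockProduced i)))
    ; start-≡ = λ p pre → trans initial-start-tokens (sym (Pre-full pre))
    ; end-≤ = λ q post → ≤-trans (≤-reflexive initial-end-tokens) z≤n
    ; end-≡ = λ needed q post → trans (idle q (needE⇒Post-BlockProduced needed post)) (sym initial-end-tokens)
    ; phase = inj₁ (ready , initial-end-tokens)
    }
    where open Ready ready

  Simulated-enabled : ∀ {M' M v} (v∈J : InBlock v) → Simulated M' M → Enabled 𝒩ⱼ M' (orig v v∈J) → Enabled 𝒩 M v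
  Simulated-enabled v∈J S en q consumes with image-touching (touches⁺-in v∈J consumes)
  ... | _ , inner-place i = ≤-trans (en _ consumes) (≤-reflexive (Simulated.inner-≡ S q i))
  ... | _ , Pre-place pre = ≤-trans (en ps (image-in v∈J consumes (Pre-place pre)))
                                    (≤-trans (m≤m+n _ _) (≤-reflexive (Simulated.start-≡ S q pre)))
  ... | _ , Post-place post = ≤-trans (en pe (image-in v∈J consumes (Post-place post)))
                                      (≤-trans (m≤m+n _ _) (Simulated.end-≤ S q post))

  -- The first block transition consumes the unique start token, which must then be on ps.
  first-firing-ps' : ∀ {M' M v} (v∈J : InBlock v) → Simulated M' M → Ready M → end-tokens M' ≡ 0 →
                     Enabled 𝒩ⱼ M' (orig v v∈J) → ps'-tokens M' ≡ 0
  first-firing-ps' {M'} {M} {v} v∈J S ready no-end en with ∃-input wf v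
  ... | q , consumes with image-touching (touches⁺-in v∈J consumes)
  ...   | _ , inner-place i =
    ⊥-elim (m<n⇒n≢0 (en _ consumes) (trans (Simulated.inner-≡ S q i) (Ready.idle ready q (Inner⇒BlockProduced i))))
  ...   | _ , Pre-place pre =
    m+n≡1⇒n≡0 (en ps (image-in v∈J consumes (Pre-place pre))) (trans (Simulated.start-≡ S q pre) (Ready.Pre-full ready pre))
  ...   | _ , Post-place post =
    ⊥-elim (m<n⇒n≢0 (en pe (image-in v∈J consumes (Post-place post))) (m+n≡0⇒m≡0 (M' pe) no-end))

  Simulated-orig : ∀ {M' M'' M v} (v∈J : InBlock v) → Simulated M' M → (en : Enabled 𝒩ⱼ M' (orig v v∈J)) →
                   _≐_ 𝒩ⱼ M'' (fire 𝒩ⱼ M' (orig v v∈J)) → Simulated M'' (fire 𝒩 M v)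
  Simulated-orig {M'} {M''} {M} {v} v∈J S en fired = record
    { inner-≡ = λ p i → trans (fired (inner p i)) (fire-cong (λ _ → M' (inner p i)) M (inner-≡ p i))
    ; start-≡ = λ p pre → trans (start-tokens′ pre) (fire-cong (λ _ → start-tokens M') M (start-≡ p pre))
    ; end-≤ = λ q post → ≤-trans (≤-reflexive (end-tokens′ post)) (fire-mono (λ _ → end-tokens M') M v q (end-≤ q post))
    ; end-≡ = λ needed q post → trans (fire-cong M (λ _ → end-tokens M') (end-≡ needed q post)) (sym (end-tokens′ post))
    ; phase = inj₂ (started phase , trans (ps'-tokens-≐ fired) (ps'-tokens′ phase))
    }
    where
    open Simulated S
    M-enabled = Simulated-enabled v∈J S en
    start-tokens′ : ∀ {p} → Pre p → start-tokens M'' ≡ fire 𝒩 (λ _ → start-tokens M') v p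
    start-tokens′ pre = trans (start-tokens-≐ fired) (start-tokens-orig v∈J pre en)
    end-tokens′ : ∀ {q} → Post q → end-tokens M'' ≡ fire 𝒩 (λ _ → end-tokens M') v q
    end-tokens′ post = trans (end-tokens-≐ fired) (end-tokens-orig v∈J post en)
    started : (Ready M × end-tokens M' ≡ 0) ⊎ (Started M × ps'-tokens M' ≡ 0) → Started (fire 𝒩 M v)
    started (inj₁ (ready , _)) = Started-start (record { Ready ready ; first = v ; first∈J = v∈J ; enabled = M-enabled })
    started (inj₂ (st , _)) = Started-step st (step-fire M-enabled)
    ps'-tokens′ : (Ready M × end-tokens M' ≡ 0) ⊎ (Started M × ps'-tokens M' ≡ 0) →
                  ps'-tokens (fire 𝒩ⱼ M' (orig v v∈J)) ≡ 0
    ps'-tokens′ p = trans (ps'-tokens-orig {M'} v∈J) (ps'-tokens-0 p)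
      where
      ps'-tokens-0 : _ → ps'-tokens M' ≡ 0
      ps'-tokens-0 (inj₁ (ready , no-end)) = first-firing-ps' v∈J S ready no-end en
      ps'-tokens-0 (inj₂ (_ , no-ps')) = no-ps'

  Simulated-stutter : ∀ {M' M'' M} → Simulated M' M → (∀ p i → M'' (inner p i) ≡ M' (inner p i)) →
                      start-tokens M'' ≡ start-tokens M' → end-tokens M'' ≡ end-tokens M' →
                      (Ready M × end-tokens M'' ≡ 0) ⊎ (Started M × ps'-tokens M'' ≡ 0) → Simulated M'' M
  Simulated-stutter S same-inner same-start same-end phase′ = record
    { inner-≡ = λ p i → trans (same-inner p i) (inner-≡ p i)
    ; start-≡ = λ p pre → trans same-start (start-≡ p pre)
    ; end-≤ = λ q post → ≤-trans (≤-reflexive same-end) (end-≤ q post)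
    ; end-≡ = λ needed q post → trans (end-≡ needed q post) (sym same-end)
    ; phase = phase′
    }
    where open Simulated S

  start-tokens-ts : ∀ {M'} w → Enabled 𝒩ⱼ M' (ts w) → start-tokens (fire 𝒩ⱼ M' (ts w)) ≡ start-tokens M'
  start-tokens-ts {M'} w en = begin
    fire 𝒩ⱼ M' (ts w) ps + ps'-tokens (fire 𝒩ⱼ M' (ts w)) ≡⟨ cong (fire 𝒩ⱼ M' (ts w) ps +_) (optional-present _ w) ⟩
    (M' ps + 1) + (M' (ps' w) ∸ 1 + 0)                    ≡⟨ [m+1]+[n∸1+0]≡m+n (M' ps) (M' (ps' w)) (en (ps' w) tt) ⟩
    M' ps + M' (ps' w)                                    ≡⟨ cong (M' ps +_) (sym (optional-present _ w)) ⟩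
    start-tokens M'                                       ∎
    where open ≡-Reasoning

  end-tokens-te : ∀ {M'} w → Enabled 𝒩ⱼ M' (te w) → end-tokens (fire 𝒩ⱼ M' (te w)) ≡ end-tokens M'
  end-tokens-te {M'} w en = begin
    fire 𝒩ⱼ M' (te w) pe + pe'-tokens (fire 𝒩ⱼ M' (te w)) ≡⟨ cong (fire 𝒩ⱼ M' (te w) pe +_) (optional-present _ w) ⟩
    (M' pe ∸ 1 + 0) + (M' (pe' w) + 1)                    ≡⟨ +-comm (M' pe ∸ 1 + 0) _ ⟩
    (M' (pe' w) + 1) + (M' pe ∸ 1 + 0)                    ≡⟨ [m+1]+[n∸1+0]≡m+n (M' (pe' w)) (M' pe) (en pe tt) ⟩
    M' (pe' w) + M' pe                                    ≡⟨ +-comm (M' (pe' w)) (M' pe) ⟩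
    M' pe + M' (pe' w)                                    ≡⟨ cong (M' pe +_) (sym (optional-present _ w)) ⟩
    end-tokens M'                                         ∎
    where open ≡-Reasoning

  Simulated-ts : ∀ {M' M'' M} w → Simulated M' M → Enabled 𝒩ⱼ M' (ts w) →
                 _≐_ 𝒩ⱼ M'' (fire 𝒩ⱼ M' (ts w)) → Simulated M'' M
  Simulated-ts {M'} {M''} w S en fired =
    Simulated-stutter S (λ p i → trans (fired (inner p i)) (+-identityʳ _)) same-start same-end phase′
    where
    open Simulated S
    same-start : start-tokens M'' ≡ start-tokens M'
    same-start = trans (start-tokens-≐ fired) (start-tokens-ts w en)
    same-end : end-tokens M'' ≡ end-tokens M'
    same-end = cong₂ _+_ (trans (fired pe) (+-identityʳ _)) (optional-cong λ w′ → trans (fired (pe' w′)) (+-identityʳ _))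
    phase′ : _
    phase′ with phase
    ... | inj₁ (ready , no-end) = inj₁ (ready , trans same-end no-end)
    ... | inj₂ (_ , no-ps') = ⊥-elim (m<n⇒n≢0 (en (ps' w) tt) (trans (sym (optional-present _ w)) no-ps'))

  Simulated-te : ∀ {M' M'' M} w → Simulated M' M → Enabled 𝒩ⱼ M' (te w) →
                 _≐_ 𝒩ⱼ M'' (fire 𝒩ⱼ M' (te w)) → Simulated M'' M
  Simulated-te {M'} {M''} w S en fired =
    Simulated-stutter S (λ p i → trans (fired (inner p i)) (+-identityʳ _)) same-start same-end phase′
    where
    open Simulated S
    same-start : start-tokens M'' ≡ start-tokens M'
    same-start = cong₂ _+_ (trans (fired ps) (+-identityʳ _)) (optional-cong λ w′ → trans (fired (ps' w′)) (+-identityʳ _))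
    same-end : end-tokens M'' ≡ end-tokens M'
    same-end = trans (end-tokens-≐ fired) (end-tokens-te w en)
    phase′ : _
    phase′ with phase
    ... | inj₁ (_ , no-end) = ⊥-elim (m<n⇒n≢0 (en pe tt) (m+n≡0⇒m≡0 (M' pe) no-end))
    ... | inj₂ (st , no-ps') =
      inj₂ (st , trans (ps'-tokens-≐ fired) (trans (optional-cong λ w′ → +-identityʳ (M' (ps' w′))) no-ps'))

  simulate : ∀ {M'} → Reach 𝒩ⱼ initialⱼ M' → ∃[ M ] Simulated M' M
  simulate = go (initial-Simulated (proj₂ some-Ready))
    where
    go : ∀ {M' M'' M} → Simulated M' M → Reach 𝒩ⱼ M' M'' → ∃[ M ] Simulated M'' M
    go S ε = _ , S
    go S ((orig v v∈J , en , fired) ◅ run) = go (Simulated-orig v∈J S en fired) run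
    go S ((ts w , en , fired) ◅ run) = go (Simulated-ts w S en fired) run
    go S ((te w , en , fired) ◅ run) = go (Simulated-te w S en fired) run

  projection-safe : Safe 𝒩ⱼ
  projection-safe M' run with simulate run
  ... | M , S = bound
    where
    open Simulated S
    start-≤1 : start-tokens M' ≤ 1
    start-≤1 = ≤-trans (≤-reflexive (start-≡ _ (proj₂ some-Pre))) (safe M reachable _)
    end-≤1 : end-tokens M' ≤ 1
    end-≤1 = ≤-trans (end-≤ _ (proj₂ some-Post)) (safe M reachable _)
    bound : ∀ x → M' x ≤ 1
    bound (inner p i) = ≤-trans (≤-reflexive (inner-≡ p i)) (safe M reachable p)
    bound ps = ≤-trans (m≤m+n _ _) start-≤1
    bound pe = ≤-trans (m≤m+n _ _) end-≤1
    bound (ps' w) = ≤-trans (≤-reflexive (sym (optional-present _ w))) (≤-trans (m≤n+m _ (M' ps)) start-≤1)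
    bound (pe' w) = ≤-trans (≤-reflexive (sym (optional-present _ w))) (≤-trans (m≤n+m _ (M' pe)) end-≤1)

  -- After the block has started, the projection can follow every run of N exactly.
  record Synced (M' : Marking 𝒩ⱼ) (M : Marking 𝒩) : Set where
    field
      inner-≡   : ∀ p (i : Inner p) → M' (inner p i) ≡ M p
      ps-≡      : ∀ p → Pre p → M' ps ≡ M p
      pe-≥      : T needE → ∀ q → Post q → M q ≤ M' pe
      ps'-empty : ps'-tokens M' ≡ 0
      pe'-empty : pe'-tokens M' ≡ 0

  Synced-≐ : ∀ {M' M M₂} → Synced M' M → _≐_ 𝒩 M₂ M → Synced M' M₂
  Synced-≐ S M₂≐M = record
    { inner-≡ = λ p i → trans (inner-≡ p i) (sym (M₂≐M p))
    ; ps-≡ = λ p pre → trans (ps-≡ p pre) (sym (M₂≐M p))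
    ; pe-≥ = λ needed q post → ≤-trans (≤-reflexive (M₂≐M q)) (pe-≥ needed q post)
    ; ps'-empty = ps'-empty
    ; pe'-empty = pe'-empty
    }
    where open Synced S

  Synced-enabled : ∀ {M' M v} (v∈J : InBlock v) → Synced M' M → Enabled 𝒩 M v → Enabled 𝒩ⱼ M' (orig v v∈J)
  Synced-enabled v∈J S en (inner p i) consumes = ≤-trans (en p consumes) (≤-reflexive (sym (Synced.inner-≡ S p i)))
  Synced-enabled {v = v} v∈J S en ps fromS-v with anyFin-∧⁻ (isPre j) (λ p → inArc p v) fromS-v
  ... | p , pre , consumes = ≤-trans (en p consumes) (≤-reflexive (sym (Synced.ps-≡ S p pre)))
  Synced-enabled {v = v} v∈J S en pe fromE-v with anyFin-∧⁻ (isPost j) (λ q → inArc q v) fromE-v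
  ... | q , post , consumes = ≤-trans (en q consumes) (Synced.pe-≥ S (in-block⁺ fromE v∈J fromE-v) q post)

  Synced-fire : ∀ {M' M v} (v∈J : InBlock v) → Synced M' M → Synced (fire 𝒩ⱼ M' (orig v v∈J)) (fire 𝒩 M v)
  Synced-fire {M'} {M} {v} v∈J S = record
    { inner-≡ = λ p i → fire-cong (λ _ → M' (inner p i)) M (inner-≡ p i)
    ; ps-≡ = λ p pre → trans (fire-image {M'} v∈J (Pre-place pre)) (fire-cong (λ _ → M' ps) M (ps-≡ p pre))
    ; pe-≥ = λ needed q post → ≤-trans (fire-mono M (λ _ → M' pe) v q (pe-≥ needed q post))
                                       (≤-reflexive (sym (fire-image {M'} v∈J (Post-place post))))
    ; ps'-empty = trans (ps'-tokens-orig {M'} v∈J) ps'-empty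
    ; pe'-empty = trans (pe'-tokens-orig {M'} v∈J) pe'-empty
    }
    where open Synced S

  Synced-outside-step : ∀ {M' M M₂ v} → Started M → Synced M' M → (en : Enabled 𝒩 M v) →
                        _≐_ 𝒩 M₂ (fire 𝒩 M v) → ¬ InBlock v → Synced M' M₂
  Synced-outside-step {M' } {M} {M₂} {v} st S en fired v∉J = record
    { inner-≡ = λ p i → trans (inner-≡ p i) (sym (trans (fired p)
                  (fire-idle M (¬T⇒≡false λ c → v∉J (proj₂ (Inner⇒BlockConsumed i) v c))
                               (¬T⇒≡false λ o → v∉J (proj₂ (Inner⇒BlockProduced i) v o)))))
    ; ps-≡ = λ p pre → trans (ps-≡ p pre) (sym (trans (fired p)
                  (fire-idle M (¬T⇒≡false (Started⇒no-Pre-consumption st v∉J en pre))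
                               (Started⇒outside-unproduced st v∉J en (inj₁ pre)))))
    ; pe-≥ = λ needed q post → ≤-trans (≤-reflexive (fired q))
                  (≤-trans (fire-≤ M (Started⇒outside-unproduced st v∉J en (inj₂ (needE⇒Post-BlockProduced needed post))))
                           (pe-≥ needed q post))
    ; ps'-empty = ps'-empty
    ; pe'-empty = pe'-empty
    }
    where open Synced S

  Synced-run : ∀ {M' M Mf} → Started M → Synced M' M → Reach 𝒩 M Mf → ∃[ M'f ] Reach 𝒩ⱼ M' M'f × Synced M'f Mf
  Synced-run st S ε = _ , ε , S
  Synced-run st S ((v , en , fired) ◅ run) with part v ≟F j
  ... | yes v∈J with Synced-run (Started-step st (v , en , fired)) (Synced-≐ (Synced-fire v∈J S) fired) run
  ...   | M'f , run′ , S′ = M'f , ℙ.step-fire (Synced-enabled v∈J S en) ◅ run′ , S′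
  Synced-run st S ((v , en , fired) ◅ run) | no v∉J =
    Synced-run (Started-step st (v , en , fired)) (Synced-outside-step st S en fired v∉J) run

  EndPlace : PPlace → Set
  EndPlace x = x ≡ pe ⊎ ∃[ w ] x ≡ pe' w

  record Finished (M' : Marking 𝒩ⱼ) : Set where
    field
      inner-empty : ∀ p i → M' (inner p i) ≡ 0
      ps-empty    : M' ps ≡ 0
      ps'-empty   : ps'-tokens M' ≡ 0
      end-one     : end-tokens M' ≡ 1

    empty-except : ∀ x → ¬ EndPlace x → M' x ≡ 0
    empty-except (inner p i) _ = inner-empty p i
    empty-except ps _ = ps-empty
    empty-except (ps' w) _ = trans (sym (optional-present _ w)) ps'-empty
    empty-except pe not-end = ⊥-elim (not-end (inj₁ refl))
    empty-except (pe' w) not-end = ⊥-elim (not-end (inj₂ (w , refl)))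

  Finished⇒final : ∀ {M'} → Finished M' → 1 ≤ M' oⱼ → _≐_ 𝒩ⱼ M' (⟦_⟧ 𝒩ⱼ oⱼ)
  Finished⇒final {M'} F marked with oⱼ-cases
  ... | inj₂ (absent , e) = subst (λ o → _≐_ 𝒩ⱼ M' (⟦_⟧ 𝒩ⱼ o)) (sym e) (ℙ.≐-⟦⟧ pe pe-one elsewhere)
    where
    open Finished F
    pe-one : M' pe ≡ 1
    pe-one = trans (sym (+-identityʳ _)) (trans (cong (M' pe +_) (sym (optional-absent _ absent))) end-one)
    elsewhere : ∀ x → x ≢ pe → M' x ≡ 0
    elsewhere x x≢pe = empty-except x λ { (inj₁ x≡pe) → x≢pe x≡pe ; (inj₂ (w , _)) → absent w }
  ... | inj₁ (w , e) = subst (λ o → _≐_ 𝒩ⱼ M' (⟦_⟧ 𝒩ⱼ o)) (sym e) (ℙ.≐-⟦⟧ (pe' w) pe'-one elsewhere)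
    where
    open Finished F
    end-sum : M' pe + M' (pe' w) ≡ 1
    end-sum = trans (cong (M' pe +_) (sym (optional-present _ w))) end-one
    pe'-marked : 1 ≤ M' (pe' w)
    pe'-marked = subst (λ o → 1 ≤ M' o) e marked
    pe-empty : M' pe ≡ 0
    pe-empty = m+n≡1⇒n≡0 pe'-marked (trans (+-comm (M' (pe' w)) (M' pe)) end-sum)
    pe'-one : M' (pe' w) ≡ 1
    pe'-one = trans (cong (_+ M' (pe' w)) (sym pe-empty)) end-sum
    elsewhere : ∀ x → x ≢ pe' w → M' x ≡ 0
    elsewhere pe _ = pe-empty
    elsewhere (pe' w′) x≢pe' = ⊥-elim (x≢pe' (cong pe' (T-irrelevant w′ w)))
    elsewhere x@(inner _ _) _ = empty-except x λ { (inj₁ ()) ; (inj₂ (_ , ())) }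
    elsewhere ps _ = empty-except ps λ { (inj₁ ()) ; (inj₂ (_ , ())) }
    elsewhere x@(ps' _) _ = empty-except x λ { (inj₁ ()) ; (inj₂ (_ , ())) }

  CanFinish : Marking 𝒩ⱼ → Set
  CanFinish M' = ∃[ M'' ] Reach 𝒩ⱼ M' M'' × _≐_ 𝒩ⱼ M'' (⟦_⟧ 𝒩ⱼ oⱼ)

  Finished-te : ∀ {M'} w → Finished M' → Enabled 𝒩ⱼ M' (te w) → Finished (fire 𝒩ⱼ M' (te w))
  Finished-te {M'} w F en = record
    { inner-empty = λ p i → trans (+-identityʳ _) (inner-empty p i)
    ; ps-empty = trans (+-identityʳ _) ps-empty
    ; ps'-empty = trans (optional-cong λ w′ → +-identityʳ (M' (ps' w′))) ps'-empty
    ; end-one = trans (end-tokens-te w en) end-one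
    }
    where open Finished F

  Finished⇒CanFinish : ∀ {M'} → Finished M' → CanFinish M'
  Finished⇒CanFinish {M'} F with oⱼ-cases
  ... | inj₂ (absent , e) = M' , ε , Finished⇒final F (subst (λ o → 1 ≤ M' o) (sym e) pe-marked)
    where
    pe-marked : 1 ≤ M' pe
    pe-marked = ≤-reflexive (sym (trans (sym (+-identityʳ _))
                  (trans (cong (M' pe +_) (sym (optional-absent _ absent))) (Finished.end-one F))))
  ... | inj₁ (w , e) with M' pe ≟ 0
  ...   | yes pe-empty = M' , ε , Finished⇒final F (subst (λ o → 1 ≤ M' o) (sym e) pe'-marked)
    where
    pe'-marked : 1 ≤ M' (pe' w)
    pe'-marked = ≤-reflexive (sym (trans (cong (_+ M' (pe' w)) (sym pe-empty))
                   (trans (cong (M' pe +_) (sym (optional-present _ w))) (Finished.end-one F))))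
  ...   | no pe-marked = fire 𝒩ⱼ M' (te w) , ℙ.step-fire en ◅ ε ,
                         Finished⇒final (Finished-te w F en)
                           (subst (λ o → 1 ≤ fire 𝒩ⱼ M' (te w) o) (sym e) (ℙ.fire-marks M' {te w} {pe' w} tt))
    where
    en : Enabled 𝒩ⱼ M' (te w)
    en pe _ = n≢0⇒n>0 pe-marked
    en (inner _ _) ()
    en ps ()
    en (ps' _) ()
    en (pe' _) ()

  Synced-final⇒Finished : ∀ {M' Mf} → Synced M' Mf → _≐_ 𝒩 Mf (⟦_⟧ 𝒩 oN) → Reach 𝒩ⱼ initialⱼ M' → Finished M'
  Synced-final⇒Finished {M'} {Mf} S final reach = record
    { inner-empty = inner-empty
    ; ps-empty = ps-empty
    ; ps'-empty = ps'-empty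
    ; end-one = trans (cong (M' pe +_) pe'-empty) (trans (+-identityʳ _) (ℙ.safe-≡1 projection-safe reach pe-marked))
    }
    where
    open Synced S
    inner-empty : ∀ p i → M' (inner p i) ≡ 0
    inner-empty p i = trans (inner-≡ p i) (trans (final p) (⟦⟧-other (proj₁ (Inner⇒BlockConsumed i))))
    ps-empty : M' ps ≡ 0
    ps-empty with some-Pre
    ... | p , pre with Pre⇒consumer pre
    ...   | _ , _ , consumes = trans (ps-≡ p pre) (trans (final p) (⟦⟧-other (consumed⇒≢oN wf consumes)))
    the-marked-place-is-pe : ∀ x → 1 ≤ M' x → 1 ≤ M' pe
    the-marked-place-is-pe pe marked = marked
    the-marked-place-is-pe (inner p i) marked = ⊥-elim (m<n⇒n≢0 marked (inner-empty p i))
    the-marked-place-is-pe ps marked = ⊥-elim (m<n⇒n≢0 marked ps-empty)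
    the-marked-place-is-pe (ps' w) marked = ⊥-elim (m<n⇒n≢0 marked (trans (sym (optional-present _ w)) ps'-empty))
    the-marked-place-is-pe (pe' w) marked = ⊥-elim (m<n⇒n≢0 marked (trans (sym (optional-present _ w)) pe'-empty))
    pe-marked : 1 ≤ M' pe
    pe-marked with ℙ.Reach-preserves-marked projection-WF reach (iⱼ , ≤-reflexive (sym (ℙ.⟦⟧-self iⱼ)))
    ... | x , marked = the-marked-place-is-pe x marked

  Synced⇒CanFinish : ∀ {M' M} → Started M → Synced M' M → Reach 𝒩ⱼ initialⱼ M' → CanFinish M'
  Synced⇒CanFinish st S reach with Sound.option sound _ (Started.reachable-now st)
  ... | Mf , run , final with Synced-run st S run
  ...   | M'f , run′ , Sf with Finished⇒CanFinish (Synced-final⇒Finished Sf final (reach ◅◅ run′))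
  ...     | M'' , run″ , final″ = M'' , run′ ◅◅ run″ , final″

  projection-proper : ∀ M' → Reach 𝒩ⱼ initialⱼ M' → 1 ≤ M' oⱼ → _≐_ 𝒩ⱼ M' (⟦_⟧ 𝒩ⱼ oⱼ)
  projection-proper M' reach marked with simulate reach
  ... | M , S = Finished⇒final (finished phase) marked
    where
    open Simulated S
    end-marked : 1 ≤ end-tokens M'
    end-marked with oⱼ-cases
    ... | inj₁ (w , e) = ≤-trans (subst (λ o → 1 ≤ M' o) e marked)
                                 (≤-trans (≤-reflexive (sym (optional-present _ w))) (m≤n+m _ (M' pe)))
    ... | inj₂ (_ , e) = ≤-trans (subst (λ o → 1 ≤ M' o) e marked) (m≤m+n _ _)
    finished : (Ready M × end-tokens M' ≡ 0) ⊎ (Started M × ps'-tokens M' ≡ 0) → Finished M'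
    finished (inj₁ (_ , no-end)) = ⊥-elim (m<n⇒n≢0 end-marked no-end)
    finished (inj₂ (st , no-ps')) = record
      { inner-empty = λ p i → trans (inner-≡ p i) (Post-marked⇒BlockConsumed-empty st Post-marked (Inner⇒BlockConsumed i))
      ; ps-empty = m+n≡0⇒m≡0 _ (trans (start-≡ _ (proj₂ some-Pre)) (Post-marked⇒Pre-empty st Post-marked (proj₂ some-Pre)))
      ; ps'-empty = no-ps'
      ; end-one = ≤-antisym (≤-trans (end-≤ _ (proj₂ some-Post)) (safe M reachable _)) end-marked
      }
      where
      Post-marked : ∀ q → Post q → 1 ≤ M q
      Post-marked q post = ≤-trans end-marked (end-≤ q post)

  Simulated⇒Synced : ∀ {M' M} → Simulated M' M → ps'-tokens M' ≡ 0 → pe'-tokens M' ≡ 0 → Synced M' M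
  Simulated⇒Synced {M'} S no-ps' no-pe' = record
    { inner-≡ = inner-≡
    ; ps-≡ = λ p pre → trans (sym (trans (cong (M' ps +_) no-ps') (+-identityʳ _))) (start-≡ p pre)
    ; pe-≥ = λ needed q post → ≤-reflexive (trans (end-≡ needed q post) (trans (cong (M' pe +_) no-pe') (+-identityʳ _)))
    ; ps'-empty = no-ps'
    ; pe'-empty = no-pe'
    }
    where open Simulated S

  CanFinish-backwards : ∀ {M' M'₁} → Reach 𝒩ⱼ M' M'₁ → CanFinish M'₁ → CanFinish M'
  CanFinish-backwards run (M'' , run′ , final) = M'' , run ◅◅ run′ , final

  -- Before the block starts, the start token may still be on ps'; move it to ps.
  Ready⇒Synced : ∀ {M' M} → Simulated M' M → Ready M → end-tokens M' ≡ 0 →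
                 ∃[ M'₁ ] Reach 𝒩ⱼ M' M'₁ × Synced M'₁ M
  Ready⇒Synced {M'} S ready no-end with T? needS
  ... | no absent = M' , ε , Simulated⇒Synced S (optional-absent _ absent) no-pe'
    where no-pe' = m+n≡0⇒n≡0 (M' pe) no-end
  ... | yes w with M' (ps' w) ≟ 0
  ...   | yes empty = M' , ε , Simulated⇒Synced S (trans (optional-present _ w) empty) no-pe'
    where no-pe' = m+n≡0⇒n≡0 (M' pe) no-end
  ...   | no marked = fire 𝒩ⱼ M' (ts w) , ℙ.step-fire en ◅ ε , Simulated⇒Synced S₁ no-ps' no-pe'
    where
    en : Enabled 𝒩ⱼ M' (ts w)
    en (ps' _) _ = subst (λ w′ → 1 ≤ M' (ps' w′)) (T-irrelevant w _) (n≢0⇒n>0 marked)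
    en (inner _ _) ()
    en ps ()
    en pe ()
    en (pe' _) ()
    S₁ : Simulated (fire 𝒩ⱼ M' (ts w)) _
    S₁ = Simulated-ts w S en (λ _ → refl)
    no-ps' : ps'-tokens (fire 𝒩ⱼ M' (ts w)) ≡ 0
    no-ps' = m+n≡1⇒n≡0 (ℙ.fire-marks M' {ts w} {ps} tt)
                    (trans (Simulated.start-≡ S₁ _ (proj₂ some-Pre)) (Ready.Pre-full ready (proj₂ some-Pre)))
    no-pe' : pe'-tokens (fire 𝒩ⱼ M' (ts w)) ≡ 0
    no-pe' = trans (optional-cong λ w′ → +-identityʳ (M' (pe' w′))) (m+n≡0⇒n≡0 (M' pe) no-end)

  Ready⇒CanFinish : ∀ {M' M} → Reach 𝒩ⱼ initialⱼ M' → Simulated M' M → Ready M → end-tokens M' ≡ 0 → CanFinish M'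
  Ready⇒CanFinish reach S ready no-end with Ready⇒Synced S ready no-end
  ... | M'₁ , run₁ , S₁ = CanFinish-backwards (run₁ ◅◅ step ◅ ε)
                            (Synced⇒CanFinish (Started-start ready) (Synced-fire first∈J S₁) (reach ◅◅ run₁ ◅◅ step ◅ ε))
    where
    open Ready ready
    step = ℙ.step-fire (Synced-enabled first∈J S₁ enabled)

  projection-option : ∀ M' → Reach 𝒩ⱼ initialⱼ M' → CanFinish M'
  projection-option M' reach with simulate reach
  ... | M , S with Simulated.phase S
  ...   | inj₁ (ready , no-end) = Ready⇒CanFinish reach S ready no-end
  ...   | inj₂ (st , no-ps') with pe'-tokens M' ≟ 0
  ...     | yes no-pe' = Synced⇒CanFinish st (Simulated⇒Synced S no-ps' no-pe') reach
  ...     | no pe'-marked = M' , ε , projection-proper M' reach oⱼ-marked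
    where
    oⱼ-marked : 1 ≤ M' oⱼ
    oⱼ-marked with oⱼ-cases
    ... | inj₁ (w , e) = subst (λ o → 1 ≤ M' o) (sym e) (n≢0⇒n>0 λ empty → pe'-marked (trans (optional-present _ w) empty))
    ... | inj₂ (absent , _) = ⊥-elim (pe'-marked (optional-absent _ absent))

  Ready⇒reachable-Synced : ∀ {X} → Ready X → ∃[ M' ] Reach 𝒩ⱼ initialⱼ M' × Synced M' X
  Ready⇒reachable-Synced ready = Ready⇒Synced (initial-Simulated ready) ready initial-end-tokens

  Started⇒reachable-Synced : ∀ {M} → Started M → ∃[ M' ] Reach 𝒩ⱼ initialⱼ M' × Synced M' M
  Started⇒reachable-Synced st with Ready⇒reachable-Synced (Started.ready st)
  ... | M'₀ , reach₀ , S₀ with Synced-run (record { Started st ; run = ε }) (Synced-≐ (Synced-fire first∈J S₀) fired) run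
    where open Started st
  ...   | M' , run′ , S = M' , reach₀ ◅◅ ℙ.step-fire (Synced-enabled first∈J S₀ enabled) ◅ run′ , S
    where open Started st

  block-transition-live : ∀ {t} (t∈J : InBlock t) → ∃[ M' ] Reach 𝒩ⱼ initialⱼ M' × Enabled 𝒩ⱼ M' (orig t t∈J)
  block-transition-live {t} t∈J with Sound.no-dead sound t
  ... | Z , reachable , en with enabled⇒Ready-or-Started reachable t∈J en
  ...   | inj₁ ready with Ready⇒reachable-Synced ready
  ...     | M' , reach , S = M' , reach , Synced-enabled t∈J S en
  block-transition-live {t} t∈J | Z , reachable , en | inj₂ st with Started⇒reachable-Synced st
  ...     | M' , reach , S = M' , reach , Synced-enabled t∈J S en

  projection-no-dead : ∀ t → ∃[ M' ] Reach 𝒩ⱼ initialⱼ M' × Enabled 𝒩ⱼ M' t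
  projection-no-dead (orig t t∈J) = block-transition-live t∈J
  projection-no-dead (ts w) = initialⱼ , ε , en
    where
    en : Enabled 𝒩ⱼ initialⱼ (ts w)
    en (ps' w′) _ = ≤-reflexive (sym (subst (λ x → ⟦_⟧ 𝒩ⱼ x (ps' w′) ≡ 1) (sym (iⱼ≡ps' w′)) (ℙ.⟦⟧-self (ps' w′))))
    en (inner _ _) ()
    en ps ()
    en pe ()
    en (pe' _) ()
  projection-no-dead (te w) with projection-option initialⱼ ε
  ... | M'' , run , final
    with ℙ.first-production (initial-elsewhere (pe' w) (λ ()) (λ _ ())) run (≤-reflexive (sym pe'-full))
    where
    pe'-full : M'' (pe' w) ≡ 1
    pe'-full = trans (final (pe' w)) (subst (λ x → ⟦_⟧ 𝒩ⱼ x (pe' w) ≡ 1) (sym (oⱼ≡pe' w)) (ℙ.⟦⟧-self (pe' w)))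
  ...   | M₁ , run₁ , te w′ , en , _ = M₁ , run₁ , subst (λ w″ → Enabled 𝒩ⱼ M₁ (te w″)) (T-irrelevant w′ w) en
  ...   | _ , _ , orig _ _ , _ , ()
  ...   | _ , _ , ts _ , _ , ()

  projection-sound : Sound 𝒩ⱼ
  projection-sound = record
    { no-dead = projection-no-dead
    ; option = projection-option
    ; proper = projection-proper
    }

lemma3 : {A : Set} {m k n : ℕ} (N : FinNet A m k) (part : Fin k → Fin n) →
    SafeSoundWF (toNet N) →
    PO.IsPOPattern N part →
    (j : Fin n) → SafeSoundWF (poproject N part j)
lemma3 N part (wf , safe , sound) po j = projection-WF , projection-safe , projection-sound
  where
  open ProjectionStructure N part wf po j using (projection-WF)
  open ProjectionRuns N part wf safe sound po j using (projection-safe; projection-sound)
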